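{- Let $m_0\ge 5$, $\mathcal B'$ the set of primes $p$ with $5\le p\le m_0$, $Q'=\prod_{p\in\mathcal B'}p$, and $h(d)=\prod_{p\in\mathcal B'}\tau_p(d\bmod p)$. With $d$ uniformly distributed modulo $Q'$, let $\bar h=\mathbb E[h]$ and $\mathrm{Var}(h)$ be the mean and variance of $h$. Then $$\frac{\mathrm{Var}(h)}{\bar h^2}=\prod_{p\in\mathcal B'}R_p-1,$$ and this quantity converges as $m_0\to\infty$ to a finite limit $C_{\mathrm{var}}\approx 0.242$.
   Context: For a prime $p\ge5$ and $d\in\mathbb Z$, $\tau_p(d)=\frac1p\#\{x\in\mathbb Z/p\mathbb Z: x\notin\{0,-2,-2d,-2-2d\}\}$ (twin prime constellation). With $d$ uniform modulo $p$, $R_p=\mathbb E[\tau_p^2]/\mathbb E[\tau_p]^2$. -}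

module Defs where

open import Data.Nat as ℕ using (ℕ; zero; suc; _≤_)
open import Data.Nat.Primality using (prime?)
open import Data.Integer as ℤ using (ℤ; +_; _%ℕ_)
open import Data.List using (List; []; _∷_; filter; upTo; map; length; foldr; drop)
open import Data.List.Membership.DecPropositional ℕ._≟_ using (_∉?_)
open import Data.Rational as ℚ using (ℚ; 0ℚ; 1ℚ; _+_; _*_; _-_; _÷_; _/_; ≢-nonZero)
open import Relation.Nullary using (yes; no)

-- residue of an integer modulo p, as a natural number in [0, p)
-- (p = 0 never occurs below: we only use primes p ≥ 5)
res : ℤ → ℕ → ℕ
res x zero    = 0
res x (suc k) = x %ℕ suc k

forbidden : ℕ → ℤ → List ℕ
forbidden p d =
  res (+ 0) p ∷ res (ℤ.- (+ 2)) p ∷ res (ℤ.- (+ 2 ℤ.* d)) p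
    ∷ res (ℤ.- (+ 2) ℤ.- (+ 2 ℤ.* d)) p ∷ []

τ : ℕ → ℤ → ℚ
τ zero    d = 0ℚ
τ (suc k) d =
  (+ length (filter (_∉? forbidden (suc k) d) (upTo (suc k)))) / suc k

-- total division on ℚ (x ÷ 0 := 0); only used with nonzero denominators
_÷'_ : ℚ → ℚ → ℚ
x ÷' y with y ℚ.≟ 0ℚ
... | yes _  = 0ℚ
... | no y≢0 = _÷_ x y {{≢-nonZero y≢0}}

sumℚ : List ℚ → ℚ
sumℚ = foldr _+_ 0ℚ

prodℚ : List ℚ → ℚ
prodℚ = foldr _*_ 1ℚ

𝔼 : ℕ → (ℕ → ℚ) → ℚ
𝔼 n f = sumℚ (map f (upTo n)) ÷' (+ n / 1)

R : ℕ → ℚ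
R p = 𝔼 p (λ d → τ p (+ d) * τ p (+ d)) ÷' (𝔼 p (λ d → τ p (+ d)) * 𝔼 p (λ d → τ p (+ d)))

𝓑' : ℕ → List ℕ
𝓑' m₀ = filter prime? (drop 5 (upTo (suc m₀)))

Q' : ℕ → ℕ
Q' m₀ = foldr ℕ._*_ 1 (𝓑' m₀)

h : ℕ → ℕ → ℚ
h m₀ d = prodℚ (map (λ p → τ p (+ res (+ d) p)) (𝓑' m₀))

hbar : ℕ → ℚ
hbar m₀ = 𝔼 (Q' m₀) (h m₀)

Var : ℕ → ℚ
Var m₀ = 𝔼 (Q' m₀) (λ d → (h m₀ d - hbar m₀) * (h m₀ d - hbar m₀))

Pm : ℕ → ℚ
Pm m₀ = prodℚ (map R (𝓑' m₀)) - 1ℚ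

{-# OPTIONS --safe #-}
-- As d runs over ℤ/Q′ℤ, the residues d mod p (p ∈ 𝓑′) run independently over ℤ/pℤ
-- (Chinese remainder theorem), so E[h] and E[h²] factor into the local moments E[τ_p]
-- and E[τ_p²], and Var(h)/h̄² = E[h²]/h̄² − 1 = ∏ R_p − 1. Counting forbidden residues
-- gives R_p = p((p−2)² + 2(p−3)² + (p−3)(p−4)²)/(p−2)⁴ ≥ 1. For the tail bound
-- W(n) = 1 + 4/(n(n−1)) one checks R_p W(p) ≤ W(p−1) for p ≥ 11, so for m ≥ 10 the
-- partial products P(m) = ∏_{p≤m} R_p increase while P(m) W(m) decrease. Every later
-- P(m′) therefore lies within P(m)(W(m) − 1) = 4P(m)/(m(m−1)) of P(m), and exact
-- evaluation at m = 100 puts all P(m), m ≥ 100, in [1.2415, 1.2425].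
module Submission where

open import Algebra.Bundles using (CommutativeRing)
import Algebra.Properties.Semiring.Sum
open import Data.Nat as ℕ using (ℕ; zero; suc; NonZero; _<_; _≤_; z≤n; s≤s; z<s; s<s)
open import Data.Fin as Fin using (Fin; toℕ; fromℕ<)
import Data.Fin.Properties as FinP
open import Data.Fin.Permutation using (Permutation; permutation)
open import Data.Integer as ℤ using (ℤ; +_; -[1+_])
import Data.Integer.DivMod as ℤDivMod
import Data.Integer.Properties as ℤP
open import Data.List using (List; []; _∷_; map; upTo; applyUpTo; filter; length; drop; _++_; [_])
import Data.List.Properties as ListP
open import Data.List.Membership.DecPropositional ℕ._≟_ using (_∈?_; _∉?_)
open import Data.List.Membership.Propositional using (_∈_; _∉_)
open import Data.List.Membership.Propositional.Properties using (∈-upTo⁺)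
open import Data.List.Relation.Binary.Subset.Propositional using (_⊆_)
import Data.List.Relation.Binary.Subset.Propositional.Properties as ⊆P
open import Data.List.Relation.Unary.All as All using (All; []; _∷_)
import Data.List.Relation.Unary.All.Properties as AllP
open import Data.List.Relation.Unary.AllPairs using ([]; _∷_)
open import Data.List.Relation.Unary.Any using (here; there)
open import Data.List.Relation.Unary.Unique.Propositional using (Unique)
import Data.List.Relation.Unary.Unique.Propositional.Properties as UniqueP
open import Data.Nat.Coprimality using (Coprime; coprime-divisor)
open import Data.Nat.Divisibility using (_∣_; divides; ∣⇒≤; _∣0; ∣1⇒≡1; ∣m+n∣m⇒∣n; n∣m*n; m%n≡0⇒n∣m)
open import Data.Nat.DivMod using (_%_; m≡m%n+[m/n]*n; m%n<n; [m+kn]%n≡m%n; m<n⇒m%n≡m; m∣n⇒o%n%m≡o%m)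
open import Data.Nat.ListAction using (product)
open import Data.Nat.ListAction.Properties using (∈⇒∣product)
open import Data.Nat.Primality using (Prime; prime?; euclidsLemma; prime⇒irreducible; productOfPrimes≢0)
import Data.Nat.Properties as ℕP
open import Data.Nat.Tactic.RingSolver using (solve-∀)
open import Data.Product using (_×_; _,_; ∃; ∃₂; ∃-syntax; proj₁; proj₂)
open import Data.Rational as ℚ using (ℚ; mkℚ; 0ℚ; 1ℚ; _+_; _*_; _-_; -_; _/_; 1/_; ∣_∣; fromℚᵘ)
import Data.Rational.Properties as ℚP
open import Data.Rational.Solver using (module +-*-Solver)
import Data.Rational.Unnormalised as ℚᵘ
import Data.Rational.Unnormalised.Properties as ℚᵘP
open import Data.Sum using (inj₁; inj₂)
open import Function using (_∘_)
open import Function.Definitions using (Injective)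
open import Relation.Binary.Definitions using (Reflexive; Transitive)
open import Relation.Binary.PropositionalEquality hiding ([_])
open import Relation.Nullary using (¬_; Dec; yes; no; contradiction)
open import Relation.Nullary.Decidable using (toWitness)

open import Defs
open +-*-Solver

module ℚΣ = Algebra.Properties.Semiring.Sum (CommutativeRing.semiring ℚP.+-*-commutativeRing)
open ℚΣ using (sum-syntax)


≤-witness : ∀ a s {b} → a ℕ.+ s ≡ b → a ≤ b
≤-witness a s a+s≡b = subst (a ≤_) a+s≡b (ℕP.m≤m+n a s)

∣∧<⇒≡0 : ∀ {m t} → m ∣ t → t < m → t ≡ 0
∣∧<⇒≡0 {t = zero}  _   _   = refl
∣∧<⇒≡0 {t = suc t} m∣t t<m = contradiction (∣⇒≤ m∣t) (ℕP.<⇒≱ t<m)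

%-≡⇒∣ : ∀ m .{{_ : NonZero m}} a b → a % m ≡ (a ℕ.+ b) % m → m ∣ b
%-≡⇒∣ m a b eq = divides (qb ℕ.∸ qa) (begin
  b                                      ≡⟨ sym (ℕP.m+n∸m≡n a b) ⟩
  (a ℕ.+ b) ℕ.∸ a                        ≡⟨ cong₂ ℕ._∸_ a+b≡ a≡ ⟩
  (r ℕ.+ qb ℕ.* m) ℕ.∸ (r ℕ.+ qa ℕ.* m)  ≡⟨ ℕP.[m+n]∸[m+o]≡n∸o r (qb ℕ.* m) (qa ℕ.* m) ⟩
  qb ℕ.* m ℕ.∸ qa ℕ.* m                  ≡⟨ sym (ℕP.*-distribʳ-∸ m qb qa) ⟩
  (qb ℕ.∸ qa) ℕ.* m                      ∎)
  where
  open ≡-Reasoning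
  r  = a % m
  qa = a ℕ./ m
  qb = (a ℕ.+ b) ℕ./ m
  a≡ : a ≡ r ℕ.+ qa ℕ.* m
  a≡ = m≡m%n+[m/n]*n a m
  a+b≡ : a ℕ.+ b ≡ r ℕ.+ qb ℕ.* m
  a+b≡ = trans (m≡m%n+[m/n]*n (a ℕ.+ b) m) (cong (ℕ._+ qb ℕ.* m) (sym eq))

chain-from-steps : ∀ {A : Set} {_≼_ : A → A → Set} → Reflexive _≼_ → Transitive _≼_ →
                   ∀ (f : ℕ → A) N → (∀ m → N ≤ m → f m ≼ f (suc m)) → ∀ {m n} → N ≤ m → m ≤ n → f m ≼ f n
chain-from-steps {_≼_ = _≼_} refl≼ trans≼ f N step {m} N≤m m≤n = go (ℕP.≤⇒≤′ m≤n)
  where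
  go : ∀ {n} → m ℕ.≤′ n → f m ≼ f n
  go ℕ.≤′-refl        = refl≼
  go (ℕ.≤′-step m≤′n) = trans≼ (go m≤′n) (step _ (ℕP.≤-trans N≤m (ℕP.≤′⇒≤ m≤′n)))

ι : ℕ → ℚ
ι n = + n / 1

-- A total inverse: recip 0ℚ = 0ℚ, as for _÷'_. With this convention recip is
-- multiplicative without side conditions.
recip : ℚ → ℚ
recip x = 1ℚ ÷' x

private
  fromℚᵘ-homo-+ : ∀ x y → fromℚᵘ (x ℚᵘ.+ y) ≡ fromℚᵘ x + fromℚᵘ y
  fromℚᵘ-homo-+ x y = ℚP.toℚᵘ-injective (ℚᵘP.≃-trans (ℚP.toℚᵘ-fromℚᵘ _)
    (ℚᵘP.≃-sym (ℚᵘP.≃-trans (ℚP.toℚᵘ-homo-+ (fromℚᵘ x) (fromℚᵘ y))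
      (ℚᵘP.+-cong (ℚP.toℚᵘ-fromℚᵘ x) (ℚP.toℚᵘ-fromℚᵘ y)))))

  fromℚᵘ-homo-* : ∀ x y → fromℚᵘ (x ℚᵘ.* y) ≡ fromℚᵘ x * fromℚᵘ y
  fromℚᵘ-homo-* x y = ℚP.toℚᵘ-injective (ℚᵘP.≃-trans (ℚP.toℚᵘ-fromℚᵘ _)
    (ℚᵘP.≃-sym (ℚᵘP.≃-trans (ℚP.toℚᵘ-homo-* (fromℚᵘ x) (fromℚᵘ y))
      (ℚᵘP.*-cong (ℚP.toℚᵘ-fromℚᵘ x) (ℚP.toℚᵘ-fromℚᵘ y)))))

  +-pos-* : ∀ a b → + a ℤ.* + b ≡ + (a ℕ.* b)
  +-pos-* a b = sym (ℤP.pos-* a b)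

/-cross : ∀ a b c d .{{_ : NonZero b}} .{{_ : NonZero d}} →
          a ℕ.* d ≡ c ℕ.* b → + a / b ≡ + c / d
/-cross a (suc b) c (suc d) e = ℚP.fromℚᵘ-cong {ℚᵘ.mkℚᵘ (+ a) b} {ℚᵘ.mkℚᵘ (+ c) d}
  (ℚᵘ.*≡* (trans (+-pos-* a (suc d)) (trans (cong +_ e) (sym (+-pos-* c (suc b))))))

/-mono-≤ : ∀ a b c d .{{_ : NonZero b}} .{{_ : NonZero d}} →
           a ℕ.* d ℕ.≤ c ℕ.* b → + a / b ℚ.≤ + c / d
/-mono-≤ a (suc b) c (suc d) le = ℚP.toℚᵘ-cancel-≤
  (ℚᵘP.≤-respˡ-≃ (ℚᵘP.≃-sym (ℚP.toℚᵘ-fromℚᵘ (ℚᵘ.mkℚᵘ (+ a) b)))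
    (ℚᵘP.≤-respʳ-≃ (ℚᵘP.≃-sym (ℚP.toℚᵘ-fromℚᵘ (ℚᵘ.mkℚᵘ (+ c) d)))
    (ℚᵘ.*≤* (subst₂ ℤ._≤_ (sym (+-pos-* a (suc d))) (sym (+-pos-* c (suc b))) (ℤ.+≤+ le)))))

/-mono-< : ∀ a b c d .{{_ : NonZero b}} .{{_ : NonZero d}} →
           a ℕ.* d ℕ.< c ℕ.* b → + a / b ℚ.< + c / d
/-mono-< a (suc b) c (suc d) lt = ℚP.toℚᵘ-cancel-<
  (ℚᵘP.<-respˡ-≃ (ℚᵘP.≃-sym (ℚP.toℚᵘ-fromℚᵘ (ℚᵘ.mkℚᵘ (+ a) b)))
    (ℚᵘP.<-respʳ-≃ (ℚᵘP.≃-sym (ℚP.toℚᵘ-fromℚᵘ (ℚᵘ.mkℚᵘ (+ c) d)))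
    (ℚᵘ.*<* (subst₂ ℤ._<_ (sym (+-pos-* a (suc d))) (sym (+-pos-* c (suc b))) (ℤ.+<+ lt)))))

/-+-/ : ∀ a b c d .{{_ : NonZero b}} .{{_ : NonZero d}} →
        + a / b + + c / d ≡ (+ (a ℕ.* d ℕ.+ c ℕ.* b) / (b ℕ.* d)) {{ℕP.m*n≢0 b d}}
/-+-/ a (suc b) c (suc d) = trans (sym (fromℚᵘ-homo-+ (ℚᵘ.mkℚᵘ (+ a) b) (ℚᵘ.mkℚᵘ (+ c) d)))
  (cong (λ n → fromℚᵘ (ℚᵘ.mkℚᵘ n (d ℕ.+ b ℕ.* suc d)))
    (trans (cong₂ ℤ._+_ (+-pos-* a (suc d)) (+-pos-* c (suc b)))
      (sym (ℤP.pos-+ (a ℕ.* suc d) (c ℕ.* suc b)))))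

/-*-/ : ∀ a b c d .{{_ : NonZero b}} .{{_ : NonZero d}} →
        + a / b * (+ c / d) ≡ (+ (a ℕ.* c) / (b ℕ.* d)) {{ℕP.m*n≢0 b d}}
/-*-/ a (suc b) c (suc d) = trans (sym (fromℚᵘ-homo-* (ℚᵘ.mkℚᵘ (+ a) b) (ℚᵘ.mkℚᵘ (+ c) d)))
  (cong (λ n → fromℚᵘ (ℚᵘ.mkℚᵘ n (d ℕ.+ b ℕ.* suc d))) (+-pos-* a c))

ι-+ : ∀ a b → ι (a ℕ.+ b) ≡ ι a + ι b
ι-+ a b = sym (trans (/-+-/ a 1 b 1)
  (ℚP./-cong (cong +_ (cong₂ ℕ._+_ (ℕP.*-identityʳ a) (ℕP.*-identityʳ b))) refl))

ι-* : ∀ a b → ι (a ℕ.* b) ≡ ι a * ι b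
ι-* a b = sym (/-*-/ a 1 b 1)

ι-pos : ∀ n .{{_ : NonZero n}} → 0ℚ ℚ.< ι n
ι-pos (suc n) = /-mono-< 0 1 (suc n) 1 (ℕ.s≤s ℕ.z≤n)

ι≢0 : ∀ n .{{_ : NonZero n}} → ι n ≢ 0ℚ
ι≢0 n = ≢-sym (ℚP.<⇒≢ (ι-pos n))

÷'≡*recip : ∀ x y → x ÷' y ≡ x * recip y
÷'≡*recip x y with y ℚ.≟ 0ℚ
... | yes _  = sym (ℚP.*-zeroʳ x)
... | no y≢0 = sym (cong (x *_) (ℚP.*-identityˡ (1/ y)))
  where instance _ = ℚ.≢-nonZero y≢0

*-recipʳ : ∀ x → x ≢ 0ℚ → x * recip x ≡ 1ℚ
*-recipʳ x x≢0 with x ℚ.≟ 0ℚ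
... | yes x≡0 = contradiction x≡0 x≢0
... | no _    = trans (cong (x *_) (ℚP.*-identityˡ (1/ x))) (ℚP.*-inverseʳ x)
  where instance _ = ℚ.≢-nonZero x≢0

recip-unique : ∀ x y → x * y ≡ 1ℚ → recip x ≡ y
recip-unique x y xy≡1 = begin
  recip x                ≡⟨ sym (ℚP.*-identityʳ (recip x)) ⟩
  recip x * 1ℚ           ≡⟨ cong (recip x *_) (sym xy≡1) ⟩
  recip x * (x * y)      ≡⟨ sym (ℚP.*-assoc (recip x) x y) ⟩
  recip x * x * y        ≡⟨ cong (_* y) (trans (ℚP.*-comm (recip x) x) (*-recipʳ x x≢0)) ⟩
  1ℚ * y                 ≡⟨ ℚP.*-identityˡ y ⟩
  y                      ∎
  where
  open ≡-Reasoning
  x≢0 : x ≢ 0ℚ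
  x≢0 refl = ℚP.1≢0 (trans (sym xy≡1) (ℚP.*-zeroˡ y))

recip-* : ∀ x y → recip (x * y) ≡ recip x * recip y
recip-* x y = cases (x ℚ.≟ 0ℚ) (y ℚ.≟ 0ℚ)
  where
  open ≡-Reasoning
  cases : Dec (x ≡ 0ℚ) → Dec (y ≡ 0ℚ) → recip (x * y) ≡ recip x * recip y
  cases (yes refl) _          = trans (cong recip (ℚP.*-zeroˡ y)) (sym (ℚP.*-zeroˡ (recip y)))
  cases (no _)     (yes refl) = trans (cong recip (ℚP.*-zeroʳ x)) (sym (ℚP.*-zeroʳ (recip x)))
  cases (no x≢0)   (no y≢0)   = recip-unique (x * y) (recip x * recip y) (begin
    x * y * (recip x * recip y)    ≡⟨ solve 4 (λ x y u v → x :* y :* (u :* v) := (x :* u) :* (y :* v)) refl x y (recip x) (recip y) ⟩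
    (x * recip x) * (y * recip y)  ≡⟨ cong₂ _*_ (*-recipʳ x x≢0) (*-recipʳ y y≢0) ⟩
    1ℚ * 1ℚ                        ≡⟨⟩
    1ℚ                             ∎)

recip-ι : ∀ n .{{_ : NonZero n}} → recip (ι n) ≡ + 1 / n
recip-ι n = recip-unique (ι n) (+ 1 / n)
  (trans (/-*-/ n 1 1 n) (/-cross (n ℕ.* 1) (1 ℕ.* n) 1 1 {{ℕP.m*n≢0 1 n}} (identity n)))
  where
  identity : ∀ n → n ℕ.* 1 ℕ.* 1 ≡ 1 ℕ.* (1 ℕ.* n)
  identity = solve-∀

recip-ι-pos : ∀ n .{{_ : NonZero n}} → 0ℚ ℚ.< recip (ι n)
recip-ι-pos n = subst (0ℚ ℚ.<_) (sym (recip-ι n)) (/-mono-< 0 1 1 n (ℕP.0<1+n))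

/≡ι*recip : ∀ a n .{{_ : NonZero n}} → + a / n ≡ ι a * recip (ι n)
/≡ι*recip a n = sym (begin
  ι a * recip (ι n)              ≡⟨ cong (ι a *_) (recip-ι n) ⟩
  ι a * (+ 1 / n)                ≡⟨ /-*-/ a 1 1 n ⟩
  (+ (a ℕ.* 1) / (1 ℕ.* n)) {{ℕP.m*n≢0 1 n}}
    ≡⟨ /-cross (a ℕ.* 1) (1 ℕ.* n) a n {{ℕP.m*n≢0 1 n}} (cong₂ ℕ._*_ (ℕP.*-identityʳ a) (sym (ℕP.*-identityˡ n))) ⟩
  + a / n                        ∎)
  where open ≡-Reasoning

ι÷'ι : ∀ a b .{{_ : NonZero b}} → ι a ÷' ι b ≡ + a / b
ι÷'ι a b = trans (÷'≡*recip (ι a) (ι b)) (sym (/≡ι*recip a b))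

*-pos : ∀ {x y} → 0ℚ ℚ.< x → 0ℚ ℚ.< y → 0ℚ ℚ.< x * y
*-pos {x} {y} 0<x 0<y = ℚP.positive⁻¹ (x * y) {{ℚP.pos*pos⇒pos x {{ℚ.positive 0<x}} y {{ℚ.positive 0<y}}}}

*-monoˡ-≤-0≤ : ∀ {x y z} → 0ℚ ℚ.≤ x → y ℚ.≤ z → x * y ℚ.≤ x * z
*-monoˡ-≤-0≤ {x} 0≤x = ℚP.*-monoˡ-≤-nonNeg x {{ℚ.nonNegative 0≤x}}

x≤x*y : ∀ {x y} → 0ℚ ℚ.≤ x → 1ℚ ℚ.≤ y → x ℚ.≤ x * y
x≤x*y {x} 0≤x 1≤y = subst (ℚ._≤ x * _) (ℚP.*-identityʳ x) (*-monoˡ-≤-0≤ 0≤x 1≤y)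

1≤⇒0≤ : ∀ {x} → 1ℚ ℚ.≤ x → 0ℚ ℚ.≤ x
1≤⇒0≤ = ℚP.≤-trans (ℚP.nonNegative⁻¹ 1ℚ)

∣z∣≤e : ∀ {z e} → - e ℚ.≤ z → z ℚ.≤ e → ∣ z ∣ ℚ.≤ e
∣z∣≤e {z} {e} -e≤z z≤e with ℚP.∣p∣≡p∨∣p∣≡-p z
... | inj₁ ∣z∣≡z  = subst (ℚ._≤ e) (sym ∣z∣≡z) z≤e
... | inj₂ ∣z∣≡-z = subst₂ ℚ._≤_ (sym ∣z∣≡-z) (solve 1 (λ e → :- (:- e) := e) refl e) (ℚP.neg-antimono-≤ -e≤z)

∣x-c∣≤e : ∀ {x c e} → c - e ℚ.≤ x → x ℚ.≤ c + e → ∣ x - c ∣ ℚ.≤ e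
∣x-c∣≤e {x} {c} {e} c-e≤x x≤c+e = ∣z∣≤e
  (subst (ℚ._≤ x - c) (solve 2 (λ c e → c :- e :- c := :- e) refl c e) (ℚP.+-monoˡ-≤ (- c) c-e≤x))
  (subst (x - c ℚ.≤_) (solve 2 (λ c e → c :+ e :- c := e) refl c e) (ℚP.+-monoˡ-≤ (- c) x≤c+e))

∣x-y∣≤b-a : ∀ {a b x y} → a ℚ.≤ x → x ℚ.≤ b → a ℚ.≤ y → y ℚ.≤ b → ∣ x - y ∣ ℚ.≤ b - a
∣x-y∣≤b-a {a} {b} {x} {y} a≤x x≤b a≤y y≤b = ∣z∣≤e
  (subst (ℚ._≤ x - y) (solve 2 (λ a b → a :- b := :- (b :- a)) refl a b) (ℚP.+-mono-≤ a≤x (ℚP.neg-antimono-≤ y≤b)))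
  (ℚP.+-mono-≤ x≤b (ℚP.neg-antimono-≤ a≤y))

positive-as-fraction : ∀ ε → 0ℚ ℚ.< ε → ∃₂ λ n d → ε ≡ + suc n / suc d
positive-as-fraction ε@(mkℚ (+ suc n) d _) _               = n , d , sym (ℚP.↥p/↧p≡p ε)
positive-as-fraction (mkℚ (+ 0) d _)       (ℚ.*<* (ℤ.+<+ ()))
positive-as-fraction (mkℚ -[1+ n ] d _)    (ℚ.*<* ())

prodℚ-map-* : ∀ {A : Set} (f g : A → ℚ) xs → prodℚ (map (λ x → f x * g x) xs) ≡ prodℚ (map f xs) * prodℚ (map g xs)
prodℚ-map-* f g []       = refl
prodℚ-map-* f g (x ∷ xs) = trans (cong (f x * g x *_) (prodℚ-map-* f g xs))
  (solve 4 (λ a b c d → a :* b :* (c :* d) := a :* c :* (b :* d)) refl (f x) (g x) (prodℚ (map f xs)) (prodℚ (map g xs)))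

prodℚ-++ : ∀ {A : Set} (f : A → ℚ) xs ys → prodℚ (map f (xs ++ ys)) ≡ prodℚ (map f xs) * prodℚ (map f ys)
prodℚ-++ f []       ys = sym (ℚP.*-identityˡ _)
prodℚ-++ f (x ∷ xs) ys = trans (cong (f x *_) (prodℚ-++ f xs ys)) (sym (ℚP.*-assoc (f x) _ _))

recip-prodℚ : ∀ {A : Set} (f : A → ℚ) xs → recip (prodℚ (map f xs)) ≡ prodℚ (map (recip ∘ f) xs)
recip-prodℚ f []       = refl
recip-prodℚ f (x ∷ xs) = trans (recip-* (f x) _) (cong (recip (f x) *_) (recip-prodℚ f xs))

prodℚ-pos : ∀ {A : Set} (f : A → ℚ) {xs} → All (λ x → 0ℚ ℚ.< f x) xs → 0ℚ ℚ.< prodℚ (map f xs)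
prodℚ-pos f []            = ℚP.positive⁻¹ 1ℚ
prodℚ-pos f (0<fx ∷ 0<fs) = *-pos 0<fx (prodℚ-pos f 0<fs)

prodℚ-÷'-square : ∀ {A : Set} (a b : A → ℚ) xs →
                  prodℚ (map b xs) * recip (prodℚ (map a xs) * prodℚ (map a xs))
                    ≡ prodℚ (map (λ x → b x ÷' (a x * a x)) xs)
prodℚ-÷'-square a b xs = begin
  prodℚ (map b xs) * recip (prodℚ (map a xs) * prodℚ (map a xs))
    ≡⟨ cong (λ y → prodℚ (map b xs) * recip y) (sym (prodℚ-map-* a a xs)) ⟩
  prodℚ (map b xs) * recip (prodℚ (map (λ x → a x * a x) xs))
    ≡⟨ cong (prodℚ (map b xs) *_) (recip-prodℚ (λ x → a x * a x) xs) ⟩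
  prodℚ (map b xs) * prodℚ (map (λ x → recip (a x * a x)) xs)
    ≡⟨ sym (prodℚ-map-* b (λ x → recip (a x * a x)) xs) ⟩
  prodℚ (map (λ x → b x * recip (a x * a x)) xs)
    ≡⟨ cong prodℚ (ListP.map-cong (λ x → sym (÷'≡*recip (b x) (a x * a x))) xs) ⟩
  prodℚ (map (λ x → b x ÷' (a x * a x)) xs)
    ∎
  where open ≡-Reasoning

1≤prodℚ : ∀ {A : Set} (f : A → ℚ) {xs} → All (λ x → 1ℚ ℚ.≤ f x) xs → 1ℚ ℚ.≤ prodℚ (map f xs)
1≤prodℚ f []            = ℚP.≤-refl
1≤prodℚ f (1≤fx ∷ 1≤fs) = ℚP.≤-trans 1≤fx (x≤x*y (1≤⇒0≤ 1≤fx) (1≤prodℚ f 1≤fs))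


-- Finite sums and the Chinese remainder theorem

sumBelow : ℕ → (ℕ → ℚ) → ℚ
sumBelow n f = ∑[ i < n ] f (toℕ i)

syntax sumBelow n (λ i → x) = Σ[ i < n ] x

sumℚ-upTo : ∀ n (f : ℕ → ℚ) → sumℚ (map f (upTo n)) ≡ Σ[ i < n ] f i
sumℚ-upTo n f = trans (cong sumℚ (ListP.map-upTo f n)) (go n f)
  where
  go : ∀ n (f : ℕ → ℚ) → sumℚ (applyUpTo f n) ≡ Σ[ i < n ] f i
  go zero    f = refl
  go (suc n) f = cong (_+_ (f 0)) (go n (f ∘ suc))

Σ-cong : ∀ n {f g : ℕ → ℚ} → (∀ i → i < n → f i ≡ g i) → Σ[ i < n ] f i ≡ Σ[ i < n ] g i
Σ-cong n f≡g = ℚΣ.sum-cong-≗ (λ i → f≡g (toℕ i) (FinP.toℕ<n i))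

Σ-+ : ∀ m n (f : ℕ → ℚ) → Σ[ k < m ℕ.+ n ] f k ≡ Σ[ i < m ] f i + Σ[ j < n ] f (m ℕ.+ j)
Σ-+ zero    n f = sym (ℚP.+-identityˡ _)
Σ-+ (suc m) n f = trans (cong (_+_ (f 0)) (Σ-+ m n (f ∘ suc))) (sym (ℚP.+-assoc (f 0) _ _))

Σ-* : ∀ m n (f : ℕ → ℚ) → Σ[ k < m ℕ.* n ] f k ≡ Σ[ i < m ] Σ[ j < n ] f (i ℕ.* n ℕ.+ j)
Σ-* zero    n f = refl
Σ-* (suc m) n f = begin
  Σ[ k < n ℕ.+ m ℕ.* n ] f k
    ≡⟨ Σ-+ n (m ℕ.* n) f ⟩
  Σ[ j < n ] f j + Σ[ k < m ℕ.* n ] f (n ℕ.+ k)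
    ≡⟨ cong (_+_ (Σ[ j < n ] f j)) (Σ-* m n (λ k → f (n ℕ.+ k))) ⟩
  Σ[ j < n ] f j + Σ[ i < m ] Σ[ j < n ] f (n ℕ.+ (i ℕ.* n ℕ.+ j))
    ≡⟨ cong (_+_ (Σ[ j < n ] f j)) (Σ-cong m (λ i _ → Σ-cong n (λ j _ → cong f (sym (ℕP.+-assoc n (i ℕ.* n) j))))) ⟩
  Σ[ j < n ] f j + Σ[ i < m ] Σ[ j < n ] f (n ℕ.+ i ℕ.* n ℕ.+ j)
    ∎
  where open ≡-Reasoning

Σ-last : ∀ n (f : ℕ → ℚ) → Σ[ i < suc n ] f i ≡ Σ[ i < n ] f i + f n
Σ-last zero    f = ℚP.+-comm (f 0) 0ℚ
Σ-last (suc n) f = trans (cong (_+_ (f 0)) (Σ-last n (f ∘ suc))) (sym (ℚP.+-assoc (f 0) _ _))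

Σ-const : ∀ n c → Σ[ i < n ] c ≡ ι n * c
Σ-const zero    c = sym (ℚP.*-zeroˡ c)
Σ-const (suc n) c = begin
  c + Σ[ i < n ] c     ≡⟨ cong (_+_ c) (Σ-const n c) ⟩
  c + ι n * c          ≡⟨ cong (_+ ι n * c) (sym (ℚP.*-identityˡ c)) ⟩
  1ℚ * c + ι n * c     ≡⟨ sym (ℚP.*-distribʳ-+ c 1ℚ (ι n)) ⟩
  (1ℚ + ι n) * c       ≡⟨ cong (_* c) (sym (ι-+ 1 n)) ⟩
  ι (suc n) * c        ∎
  where open ≡-Reasoning

Σ-*ˡ : ∀ n c (f : ℕ → ℚ) → Σ[ i < n ] (c * f i) ≡ c * Σ[ i < n ] f i
Σ-*ˡ n c f = sym (ℚΣ.*-distribˡ-sum {n} c (λ i → f (toℕ i)))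

Σ-*ʳ : ∀ n c (f : ℕ → ℚ) → Σ[ i < n ] (f i * c) ≡ Σ[ i < n ] f i * c
Σ-*ʳ n c f = sym (ℚΣ.*-distribʳ-sum {n} c (λ i → f (toℕ i)))

Σ-distrib-+ : ∀ n (f g : ℕ → ℚ) → Σ[ i < n ] (f i + g i) ≡ Σ[ i < n ] f i + Σ[ i < n ] g i
Σ-distrib-+ n f g = ℚΣ.∑-distrib-+ {n} (λ i → f (toℕ i)) (λ i → g (toℕ i))

Σ-comm : ∀ m n (f : ℕ → ℕ → ℚ) → Σ[ i < m ] Σ[ j < n ] f i j ≡ Σ[ j < n ] Σ[ i < m ] f i j
Σ-comm m n f = ℚΣ.∑-comm {m} {n} (λ i j → f (toℕ i) (toℕ j))

injective⇒surjective : ∀ {n} {f : Fin n → Fin n} → Injective _≡_ _≡_ f → ∀ y → ∃ λ x → f x ≡ y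
injective⇒surjective {suc n} {f} f-inj y with FinP.any? (λ x → f x Fin.≟ y)
... | yes hit = hit
... | no miss = contradiction (FinP.injective⇒≤ g-inj) ℕP.1+n≰n
  where
  y≢f : ∀ x → y ≢ f x
  y≢f x e = miss (x , sym e)
  g : Fin (suc n) → Fin n
  g x = Fin.punchOut (y≢f x)
  g-inj : Injective _≡_ _≡_ g
  g-inj {x} {x′} = f-inj ∘ FinP.punchOut-injective (y≢f x) (y≢f x′)

injective⇒permutation : ∀ {n} (f : Fin n → Fin n) → Injective _≡_ _≡_ f → Permutation n n
injective⇒permutation f f-inj = permutation f f⁻¹ (proj₂ ∘ surj) (λ x → f-inj (proj₂ (surj (f x))))
  where
  surj = injective⇒surjective f-inj
  f⁻¹ = proj₁ ∘ surj

affine-%-cancel : ∀ {m n} .{{_ : NonZero m}} → Coprime m n → ∀ i j t → t < m →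
                  (i ℕ.* n ℕ.+ j) % m ≡ ((i ℕ.+ t) ℕ.* n ℕ.+ j) % m → t ≡ 0
affine-%-cancel {m} {n} cop i j t t<m eq = ∣∧<⇒≡0 (coprime-divisor cop m∣n*t) t<m
  where
  shift : ∀ i j t n → (i ℕ.+ t) ℕ.* n ℕ.+ j ≡ i ℕ.* n ℕ.+ j ℕ.+ t ℕ.* n
  shift = solve-∀
  m∣n*t : m ∣ n ℕ.* t
  m∣n*t = subst (m ∣_) (ℕP.*-comm t n)
    (%-≡⇒∣ m (i ℕ.* n ℕ.+ j) (t ℕ.* n) (trans eq (cong (_% m) (shift i j t n))))

affine-%-injective-≤ : ∀ {m n} .{{_ : NonZero m}} → Coprime m n → ∀ j {i i′} → i ≤ i′ → i′ < m →
                       (i ℕ.* n ℕ.+ j) % m ≡ (i′ ℕ.* n ℕ.+ j) % m → i ≡ i′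
affine-%-injective-≤ {m} {n} cop j {i} {i′} i≤i′ i′<m eq = begin
  i            ≡⟨ sym (ℕP.+-identityʳ i) ⟩
  i ℕ.+ 0      ≡⟨ cong (i ℕ.+_) (sym t≡0) ⟩
  i ℕ.+ t      ≡⟨ i+t≡i′ ⟩
  i′           ∎
  where
  open ≡-Reasoning
  t = i′ ℕ.∸ i
  i+t≡i′ : i ℕ.+ t ≡ i′
  i+t≡i′ = ℕP.m+[n∸m]≡n i≤i′
  t≡0 : t ≡ 0
  t≡0 = affine-%-cancel cop i j t (ℕP.≤-<-trans (ℕP.m∸n≤m i′ i) i′<m)
          (trans eq (cong (λ k → (k ℕ.* n ℕ.+ j) % m) (sym i+t≡i′)))

affine-%-injective : ∀ {m n} .{{_ : NonZero m}} → Coprime m n → ∀ j {i i′} → i < m → i′ < m →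
                     (i ℕ.* n ℕ.+ j) % m ≡ (i′ ℕ.* n ℕ.+ j) % m → i ≡ i′
affine-%-injective cop j {i} {i′} i<m i′<m eq with ℕP.≤-total i i′
... | inj₁ i≤i′ = affine-%-injective-≤ cop j i≤i′ i′<m eq
... | inj₂ i′≤i = sym (affine-%-injective-≤ cop j i′≤i i<m (sym eq))

affine-%-self : ∀ n .{{_ : NonZero n}} i {j} → j < n → (i ℕ.* n ℕ.+ j) % n ≡ j
affine-%-self n i {j} j<n = begin
  (i ℕ.* n ℕ.+ j) % n  ≡⟨ cong (_% n) (ℕP.+-comm (i ℕ.* n) j) ⟩
  (j ℕ.+ i ℕ.* n) % n  ≡⟨ [m+kn]%n≡m%n j i n ⟩
  j % n                ≡⟨ m<n⇒m%n≡m j<n ⟩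
  j                    ∎
  where open ≡-Reasoning

Σ-affine-% : ∀ {m n} .{{_ : NonZero m}} → Coprime m n → ∀ j (F : ℕ → ℚ) →
             Σ[ i < m ] F ((i ℕ.* n ℕ.+ j) % m) ≡ Σ[ r < m ] F r
Σ-affine-% {m} {n} cop j F =
  sym (trans (ℚΣ.∑-permute (F ∘ toℕ) π) (ℚΣ.sum-cong-≗ {m} (λ i → cong F (toℕ-φ i))))
  where
  φ : Fin m → Fin m
  φ i = fromℕ< (m%n<n (toℕ i ℕ.* n ℕ.+ j) m)
  toℕ-φ : ∀ i → toℕ (φ i) ≡ (toℕ i ℕ.* n ℕ.+ j) % m
  toℕ-φ i = FinP.toℕ-fromℕ< (m%n<n (toℕ i ℕ.* n ℕ.+ j) m)
  φ-inj : Injective _≡_ _≡_ φ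
  φ-inj {i} {i′} φi≡φi′ = FinP.toℕ-injective (affine-%-injective cop j (FinP.toℕ<n i) (FinP.toℕ<n i′)
    (trans (sym (toℕ-φ i)) (trans (cong toℕ φi≡φi′) (toℕ-φ i′))))
  π : Permutation m m
  π = injective⇒permutation φ φ-inj

Σ-crt : ∀ {m n} .{{_ : NonZero m}} .{{_ : NonZero n}} → Coprime m n → (F G : ℕ → ℚ) →
        Σ[ d < m ℕ.* n ] (F (d % m) * G (d % n)) ≡ Σ[ r < m ] F r * Σ[ s < n ] G s
Σ-crt {m} {n} cop F G = begin
  Σ[ d < m ℕ.* n ] (F (d % m) * G (d % n))
    ≡⟨ Σ-* m n (λ d → F (d % m) * G (d % n)) ⟩
  Σ[ i < m ] Σ[ j < n ] (F (a i j % m) * G (a i j % n))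
    ≡⟨ Σ-cong m (λ i _ → Σ-cong n (λ j j<n → cong (λ s → F (a i j % m) * G s) (affine-%-self n i j<n))) ⟩
  Σ[ i < m ] Σ[ j < n ] (F (a i j % m) * G j)
    ≡⟨ Σ-comm m n (λ i j → F (a i j % m) * G j) ⟩
  Σ[ j < n ] Σ[ i < m ] (F (a i j % m) * G j)
    ≡⟨ Σ-cong n (λ j _ → Σ-*ʳ m (G j) (λ i → F (a i j % m))) ⟩
  Σ[ j < n ] (Σ[ i < m ] F (a i j % m) * G j)
    ≡⟨ Σ-cong n (λ j _ → cong (_* G j) (Σ-affine-% cop j F)) ⟩
  Σ[ j < n ] (Σ[ r < m ] F r * G j)
    ≡⟨ Σ-*ˡ n (Σ[ r < m ] F r) G ⟩
  Σ[ r < m ] F r * Σ[ s < n ] G s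
    ∎
  where
  open ≡-Reasoning
  a : ℕ → ℕ → ℕ
  a i j = i ℕ.* n ℕ.+ j


𝔼≡Σ*recip : ∀ n (f : ℕ → ℚ) → 𝔼 n f ≡ Σ[ d < n ] f d * recip (ι n)
𝔼≡Σ*recip n f = trans (÷'≡*recip _ (ι n)) (cong (_* recip (ι n)) (sumℚ-upTo n f))

𝔼-cong : ∀ n {f g : ℕ → ℚ} → (∀ d → d < n → f d ≡ g d) → 𝔼 n f ≡ 𝔼 n g
𝔼-cong n {f} {g} f≡g = begin
  𝔼 n f                         ≡⟨ 𝔼≡Σ*recip n f ⟩
  Σ[ d < n ] f d * recip (ι n)  ≡⟨ cong (_* recip (ι n)) (Σ-cong n f≡g) ⟩
  Σ[ d < n ] g d * recip (ι n)  ≡⟨ sym (𝔼≡Σ*recip n g) ⟩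
  𝔼 n g                         ∎
  where open ≡-Reasoning

𝔼-+ : ∀ n (f g : ℕ → ℚ) → 𝔼 n (λ d → f d + g d) ≡ 𝔼 n f + 𝔼 n g
𝔼-+ n f g = begin
  𝔼 n (λ d → f d + g d)                          ≡⟨ 𝔼≡Σ*recip n _ ⟩
  Σ[ d < n ] (f d + g d) * recip (ι n)           ≡⟨ cong (_* recip (ι n)) (Σ-distrib-+ n f g) ⟩
  (Σ[ d < n ] f d + Σ[ d < n ] g d) * recip (ι n) ≡⟨ ℚP.*-distribʳ-+ (recip (ι n)) (Σ[ d < n ] f d) (Σ[ d < n ] g d) ⟩
  Σ[ d < n ] f d * recip (ι n) + Σ[ d < n ] g d * recip (ι n)
                                                 ≡⟨ sym (cong₂ _+_ (𝔼≡Σ*recip n f) (𝔼≡Σ*recip n g)) ⟩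
  𝔼 n f + 𝔼 n g                                  ∎
  where open ≡-Reasoning

𝔼-*ˡ : ∀ n c (f : ℕ → ℚ) → 𝔼 n (λ d → c * f d) ≡ c * 𝔼 n f
𝔼-*ˡ n c f = begin
  𝔼 n (λ d → c * f d)                 ≡⟨ 𝔼≡Σ*recip n _ ⟩
  Σ[ d < n ] (c * f d) * recip (ι n)  ≡⟨ cong (_* recip (ι n)) (Σ-*ˡ n c f) ⟩
  c * Σ[ d < n ] f d * recip (ι n)    ≡⟨ ℚP.*-assoc c _ _ ⟩
  c * (Σ[ d < n ] f d * recip (ι n))  ≡⟨ cong (c *_) (sym (𝔼≡Σ*recip n f)) ⟩
  c * 𝔼 n f                           ∎
  where open ≡-Reasoning

𝔼-const : ∀ n .{{_ : NonZero n}} c → 𝔼 n (λ _ → c) ≡ c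
𝔼-const n c = begin
  𝔼 n (λ _ → c)                 ≡⟨ 𝔼≡Σ*recip n _ ⟩
  Σ[ d < n ] c * recip (ι n)    ≡⟨ cong (_* recip (ι n)) (Σ-const n c) ⟩
  ι n * c * recip (ι n)         ≡⟨ solve 3 (λ a c u → a :* c :* u := c :* (a :* u)) refl (ι n) c (recip (ι n)) ⟩
  c * (ι n * recip (ι n))       ≡⟨ cong (c *_) (*-recipʳ (ι n) (ι≢0 n)) ⟩
  c * 1ℚ                        ≡⟨ ℚP.*-identityʳ c ⟩
  c                             ∎
  where open ≡-Reasoning

𝔼-variance : ∀ n .{{_ : NonZero n}} (f : ℕ → ℚ) →
             𝔼 n (λ d → (f d - 𝔼 n f) * (f d - 𝔼 n f)) ≡ 𝔼 n (λ d → f d * f d) - 𝔼 n f * 𝔼 n f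
𝔼-variance n f = begin
  𝔼 n (λ d → (f d - μ) * (f d - μ))
    ≡⟨ 𝔼-cong n (λ d _ → square-expand (f d) μ) ⟩
  𝔼 n (λ d → (f d * f d + - (μ + μ) * f d) + μ * μ)
    ≡⟨ 𝔼-+ n _ _ ⟩
  𝔼 n (λ d → f d * f d + - (μ + μ) * f d) + 𝔼 n (λ _ → μ * μ)
    ≡⟨ cong₂ _+_ (𝔼-+ n _ _) (𝔼-const n (μ * μ)) ⟩
  (𝔼 n (λ d → f d * f d) + 𝔼 n (λ d → - (μ + μ) * f d)) + μ * μ
    ≡⟨ cong (λ x → (𝔼 n (λ d → f d * f d) + x) + μ * μ) (𝔼-*ˡ n (- (μ + μ)) f) ⟩
  (𝔼 n (λ d → f d * f d) + - (μ + μ) * μ) + μ * μ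
    ≡⟨ solve 2 (λ s m → (s :+ :- (m :+ m) :* m) :+ m :* m := s :- m :* m) refl (𝔼 n (λ d → f d * f d)) μ ⟩
  𝔼 n (λ d → f d * f d) - μ * μ
    ∎
  where
  open ≡-Reasoning
  μ = 𝔼 n f
  square-expand : ∀ x c → (x - c) * (x - c) ≡ (x * x + - (c + c) * x) + c * c
  square-expand = solve 2 (λ x c → (x :- c) :* (x :- c) := (x :* x :+ :- (c :+ c) :* x) :+ c :* c) refl

𝔼-crt : ∀ {m n} .{{_ : NonZero m}} .{{_ : NonZero n}} → Coprime m n → (F G : ℕ → ℚ) →
        𝔼 (m ℕ.* n) (λ d → F (d % m) * G (d % n)) ≡ 𝔼 m F * 𝔼 n G
𝔼-crt {m} {n} cop F G = begin
  𝔼 (m ℕ.* n) (λ d → F (d % m) * G (d % n))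
    ≡⟨ 𝔼≡Σ*recip (m ℕ.* n) _ ⟩
  Σ[ d < m ℕ.* n ] (F (d % m) * G (d % n)) * recip (ι (m ℕ.* n))
    ≡⟨ cong₂ _*_ (Σ-crt cop F G) (trans (cong recip (ι-* m n)) (recip-* (ι m) (ι n))) ⟩
  (ΣF * ΣG) * (recip (ι m) * recip (ι n))
    ≡⟨ solve 4 (λ a b u v → (a :* b) :* (u :* v) := (a :* u) :* (b :* v)) refl ΣF ΣG (recip (ι m)) (recip (ι n)) ⟩
  (ΣF * recip (ι m)) * (ΣG * recip (ι n))
    ≡⟨ sym (cong₂ _*_ (𝔼≡Σ*recip m F) (𝔼≡Σ*recip n G)) ⟩
  𝔼 m F * 𝔼 n G
    ∎
  where
  open ≡-Reasoning
  ΣF = Σ[ r < m ] F r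
  ΣG = Σ[ s < n ] G s

prime∤product : ∀ {p ps} → Prime p → All Prime ps → p ∉ ps → ¬ p ∣ product ps
prime∤product {ps = []}     pp []         _   p∣1 = contradiction (subst Prime (∣1⇒≡1 p∣1) pp) λ ()
prime∤product {ps = q ∷ ps} pp (pq ∷ pps) p∉ p∣ with euclidsLemma q (product ps) pp p∣
... | inj₂ p∣Q = prime∤product pp pps (p∉ ∘ there) p∣Q
... | inj₁ p∣q with prime⇒irreducible pq p∣q
...   | inj₁ p≡1 = contradiction (subst Prime p≡1 pp) λ ()
...   | inj₂ p≡q = p∉ (here p≡q)

prime∤⇒coprime : ∀ {p n} → Prime p → ¬ p ∣ n → Coprime p n
prime∤⇒coprime pp p∤n (i∣p , i∣n) with prime⇒irreducible pp i∣p
... | inj₁ i≡1 = i≡1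
... | inj₂ i≡p = contradiction (subst (_∣ _) i≡p i∣n) p∤n

res-% : ∀ q Q .{{_ : NonZero Q}} d → q ∣ Q → res (+ (d % Q)) q ≡ res (+ d) q
res-% zero    Q d _   = refl
res-% (suc q) Q d q∣Q = m∣n⇒o%n%m≡o%m (suc q) Q d q∣Q

𝔼-∏ : ∀ ps → All Prime ps → Unique ps → (g : ℕ → ℕ → ℚ) →
      𝔼 (product ps) (λ d → prodℚ (map (λ p → g p (res (+ d) p)) ps)) ≡ prodℚ (map (λ p → 𝔼 p (g p)) ps)
𝔼-∏ []             []         []         g = 𝔼-const 1 1ℚ
𝔼-∏ (zero  ∷ ps)   (() ∷ _)   _          g
𝔼-∏ (p@(suc _) ∷ ps) (pp ∷ pps) (p∉ ∷ u) g = begin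
  𝔼 (p ℕ.* Q) (λ d → g p (d % p) * H d)          ≡⟨ 𝔼-cong (p ℕ.* Q) (λ d _ → cong (g p (d % p) *_) (sym (H-% d))) ⟩
  𝔼 (p ℕ.* Q) (λ d → g p (d % p) * H (d % Q))    ≡⟨ 𝔼-crt p⊥Q (g p) H ⟩
  𝔼 p (g p) * 𝔼 Q H                              ≡⟨ cong (𝔼 p (g p) *_) (𝔼-∏ ps pps u g) ⟩
  𝔼 p (g p) * prodℚ (map (λ p → 𝔼 p (g p)) ps)   ∎
  where
  open ≡-Reasoning
  Q = product ps
  instance
    Q≢0 : NonZero Q
    Q≢0 = productOfPrimes≢0 pps
  p⊥Q : Coprime p Q
  p⊥Q = prime∤⇒coprime pp (prime∤product pp pps (AllP.All¬⇒¬Any p∉))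
  H : ℕ → ℚ
  H d = prodℚ (map (λ q → g q (res (+ d) q)) ps)
  H-% : ∀ d → H (d % Q) ≡ H d
  H-% d = cong prodℚ (ListP.map-cong-local {xs = ps}
    (All.tabulate (λ {q} q∈ps → cong (g q) (res-% q Q d (∈⇒∣product q∈ps)))))

module _ (g : ℕ → ℕ → ℚ) where

  crtProduct : List ℕ → ℕ → ℚ
  crtProduct ps d = prodℚ (map (λ p → g p (res (+ d) p)) ps)

  momentRatio : ℕ → ℚ
  momentRatio p = 𝔼 p (λ r → g p r * g p r) ÷' (𝔼 p (g p) * 𝔼 p (g p))

  relative-variance-crtProduct :
    ∀ ps → All Prime ps → Unique ps → All (λ p → 0ℚ ℚ.< 𝔼 p (g p)) ps →
    let μ = 𝔼 (product ps) (crtProduct ps) in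
    𝔼 (product ps) (λ d → (crtProduct ps d - μ) * (crtProduct ps d - μ)) ÷' (μ * μ)
      ≡ prodℚ (map momentRatio ps) - 1ℚ
  relative-variance-crtProduct ps primes unique 𝔼g>0 = begin
    𝔼 Q (λ d → (H d - μ) * (H d - μ)) ÷' (μ * μ)
      ≡⟨ ÷'≡*recip _ (μ * μ) ⟩
    𝔼 Q (λ d → (H d - μ) * (H d - μ)) * recip (μ * μ)
      ≡⟨ cong (_* recip (μ * μ)) (𝔼-variance Q H) ⟩
    (𝔼 Q H² - μ * μ) * recip (μ * μ)
      ≡⟨ solve 3 (λ s a u → (s :- a) :* u := s :* u :- a :* u) refl (𝔼 Q H²) (μ * μ) (recip (μ * μ)) ⟩
    𝔼 Q H² * recip (μ * μ) - μ * μ * recip (μ * μ)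
      ≡⟨ cong₂ (λ x y → x * recip (y * y) - μ * μ * recip (μ * μ)) 𝔼H²≡ μ≡ ⟩
    prodℚ (map B ps) * recip (prodℚ (map A ps) * prodℚ (map A ps)) - μ * μ * recip (μ * μ)
      ≡⟨ cong₂ _-_ (prodℚ-÷'-square A B ps) (*-recipʳ (μ * μ) μ²≢0) ⟩
    prodℚ (map momentRatio ps) - 1ℚ
      ∎
    where
    open ≡-Reasoning
    Q = product ps
    instance
      Q≢0 : NonZero Q
      Q≢0 = productOfPrimes≢0 primes
    H = crtProduct ps
    H² = λ d → H d * H d
    μ = 𝔼 Q H
    A = λ p → 𝔼 p (g p)
    B = λ p → 𝔼 p (λ r → g p r * g p r)
    μ≡ : μ ≡ prodℚ (map A ps)
    μ≡ = 𝔼-∏ ps primes unique g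
    𝔼H²≡ : 𝔼 Q H² ≡ prodℚ (map B ps)
    𝔼H²≡ = trans (𝔼-cong Q (λ d _ → sym (prodℚ-map-* _ _ ps))) (𝔼-∏ ps primes unique (λ p r → g p r * g p r))
    μ²≢0 : μ * μ ≢ 0ℚ
    μ²≢0 = ≢-sym (ℚP.<⇒≢ (*-pos μ>0 μ>0))
      where μ>0 = subst (0ℚ ℚ.<_) (sym μ≡) (prodℚ-pos A 𝔼g>0)


-- The local factor τ_p

avoiding : List ℕ → List ℕ → ℕ
avoiding L xs = length (filter (_∉? L) xs)

avoiding-accept : ∀ {L x} xs → x ∉ L → avoiding L (x ∷ xs) ≡ suc (avoiding L xs)
avoiding-accept xs x∉L = cong length (ListP.filter-accept (_∉? _) {xs = xs} x∉L)

avoiding-reject : ∀ {L x} xs → x ∈ L → avoiding L (x ∷ xs) ≡ avoiding L xs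
avoiding-reject xs x∈L = cong length (ListP.filter-reject (_∉? _) {xs = xs} (λ x∉L → x∉L x∈L))

avoiding-cong : ∀ {L L′} → L ⊆ L′ → L′ ⊆ L → ∀ xs → avoiding L xs ≡ avoiding L′ xs
avoiding-cong L⊆L′ L′⊆L xs = cong length (ListP.filter-≐ (_∉? _) (_∉? _) ((_∘ L′⊆L) , (_∘ L⊆L′)) xs)

avoiding-∷-absent : ∀ {a L} xs → a ∉ xs → avoiding (a ∷ L) xs ≡ avoiding L xs
avoiding-∷-absent []       _  = refl
avoiding-∷-absent {a} {L} (x ∷ xs) a∉ = cases (x ∈? L)
  where
  ih = avoiding-∷-absent xs (a∉ ∘ there)
  cases : Dec (x ∈ L) → avoiding (a ∷ L) (x ∷ xs) ≡ avoiding L (x ∷ xs)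
  cases (yes x∈L) = trans (avoiding-reject xs (there x∈L)) (trans ih (sym (avoiding-reject xs x∈L)))
  cases (no  x∉L) = trans (avoiding-accept xs λ { (here x≡a) → a∉ (here (sym x≡a)) ; (there x∈L) → x∉L x∈L })
                      (trans (cong suc ih) (sym (avoiding-accept xs x∉L)))

avoiding-∷-present : ∀ {a L} xs → Unique xs → a ∈ xs → a ∉ L → suc (avoiding (a ∷ L) xs) ≡ avoiding L xs
avoiding-∷-present {a} {L} (x ∷ xs) (x∉xs ∷ _) (here refl) a∉L =
  trans (cong suc (trans (avoiding-reject xs (here refl)) (avoiding-∷-absent xs (λ a∈ → All.lookup x∉xs a∈ refl))))
        (sym (avoiding-accept xs a∉L))
avoiding-∷-present {a} {L} (x ∷ xs) (x≢xs ∷ u) (there a∈xs) a∉L = cases (x ∈? L)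
  where
  ih = avoiding-∷-present xs u a∈xs a∉L
  cases : Dec (x ∈ L) → suc (avoiding (a ∷ L) (x ∷ xs)) ≡ avoiding L (x ∷ xs)
  cases (yes x∈L) = trans (cong suc (avoiding-reject xs (there x∈L))) (trans ih (sym (avoiding-reject xs x∈L)))
  cases (no  x∉L) =
    trans (cong suc (avoiding-accept xs λ { (here x≡a) → All.lookup x≢xs a∈xs x≡a ; (there x∈L) → x∉L x∈L }))
          (trans (cong suc ih) (sym (avoiding-accept xs x∉L)))

avoiding-unique : ∀ n {L} → Unique L → All (_< n) L → avoiding L (upTo n) ℕ.+ length L ≡ n
avoiding-unique n {[]}    _          _           = begin
  avoiding [] (upTo n) ℕ.+ 0   ≡⟨ ℕP.+-identityʳ _ ⟩
  length (filter (_∉? []) (upTo n)) ≡⟨ cong length (ListP.filter-all (_∉? []) {upTo n} (All.tabulate (λ _ ()))) ⟩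
  length (upTo n)              ≡⟨ ListP.length-upTo n ⟩
  n                            ∎
  where open ≡-Reasoning
avoiding-unique n {a ∷ L} (a∉L ∷ u) (a<n ∷ L<n) = begin
  avoiding (a ∷ L) (upTo n) ℕ.+ suc (length L)   ≡⟨ ℕP.+-suc _ (length L) ⟩
  suc (avoiding (a ∷ L) (upTo n)) ℕ.+ length L   ≡⟨ cong (ℕ._+ length L) drop-a ⟩
  avoiding L (upTo n) ℕ.+ length L               ≡⟨ avoiding-unique n u L<n ⟩
  n                                              ∎
  where
  open ≡-Reasoning
  drop-a : suc (avoiding (a ∷ L) (upTo n)) ≡ avoiding L (upTo n)
  drop-a = avoiding-∷-present (upTo n) (UniqueP.upTo⁺ n) (∈-upTo⁺ a<n) (λ a∈L → All.lookup a∉L a∈L refl)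

map-unique : ∀ {P : ℕ → Set} (f : ℕ → ℕ) → (∀ {x y} → P x → P y → f x ≡ f y → x ≡ y) →
             ∀ {xs} → All P xs → Unique xs → Unique (map f xs)
map-unique f f-inj []          []          = []
map-unique {P} f f-inj {x ∷ _} (px ∷ pxs) (x∉xs ∷ u) = separated pxs x∉xs ∷ map-unique f f-inj pxs u
  where
  separated : ∀ {ys} → All P ys → All (x ≢_) ys → All (f x ≢_) (map f ys)
  separated []          []              = []
  separated (py ∷ pys) (x≢y ∷ x≢ys) = (x≢y ∘ f-inj px py) ∷ separated pys x≢ys

negRes : ℕ → ℕ → ℕ
negRes p N = res (ℤ.- (+ N)) p

negRes<p : ∀ p .{{_ : NonZero p}} N → negRes p N < p
negRes<p (suc m) N = ℤDivMod.n%ℕd<d (ℤ.- (+ N)) (suc m)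

negRes-∣ : ∀ p .{{_ : NonZero p}} N → p ∣ negRes p N ℕ.+ N
negRes-∣ (suc m) zero    = suc m ∣0
negRes-∣ (suc m) (suc n) with suc n % suc m in eq
... | zero  = m%n≡0⇒n∣m (suc n) (suc m) eq
... | suc r = divides (suc q) (begin
  (suc m ℕ.∸ suc r) ℕ.+ suc n                    ≡⟨ cong ((suc m ℕ.∸ suc r) ℕ.+_) n≡ ⟩
  (suc m ℕ.∸ suc r) ℕ.+ (suc r ℕ.+ q ℕ.* suc m)  ≡⟨ sym (ℕP.+-assoc (suc m ℕ.∸ suc r) (suc r) _) ⟩
  (suc m ℕ.∸ suc r) ℕ.+ suc r ℕ.+ q ℕ.* suc m    ≡⟨ cong (ℕ._+ q ℕ.* suc m) (ℕP.m∸n+n≡m r<m) ⟩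
  suc m ℕ.+ q ℕ.* suc m                          ∎)
  where
  open ≡-Reasoning
  q = suc n ℕ./ suc m
  n≡ : suc n ≡ suc r ℕ.+ q ℕ.* suc m
  n≡ = trans (m≡m%n+[m/n]*n (suc n) (suc m)) (cong (ℕ._+ q ℕ.* suc m) eq)
  r<m : suc r ≤ suc m
  r<m = ℕP.<⇒≤ (subst (_< suc m) eq (m%n<n (suc n) (suc m)))

negRes-≡⇒∣ : ∀ p .{{_ : NonZero p}} {a b} → a ≤ b → negRes p a ≡ negRes p b → p ∣ b ℕ.∸ a
negRes-≡⇒∣ p {a} {b} a≤b eq = ∣m+n∣m⇒∣n (subst (p ∣_) split (negRes-∣ p b)) (negRes-∣ p a)
  where
  split : negRes p b ℕ.+ b ≡ negRes p a ℕ.+ a ℕ.+ (b ℕ.∸ a)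
  split = trans (cong₂ ℕ._+_ (sym eq) (sym (ℕP.m+[n∸m]≡n a≤b))) (sym (ℕP.+-assoc _ a (b ℕ.∸ a)))

module _ {p} .{{_ : NonZero p}} (p-prime : Prime p) (p∤2 : ¬ p ∣ 2) where

  private
    2*-gap : ∀ {a b} → a ≤ b → b < p → negRes p (2 ℕ.* a) ≡ negRes p (2 ℕ.* b) → b ≤ a
    2*-gap {a} {b} a≤b b<p eq = ℕP.m∸n≡0⇒m≤n (∣∧<⇒≡0 p∣b∸a (ℕP.≤-<-trans (ℕP.m∸n≤m b a) b<p))
      where
      p∣2[b∸a] : p ∣ 2 ℕ.* (b ℕ.∸ a)
      p∣2[b∸a] = subst (p ∣_) (sym (ℕP.*-distribˡ-∸ 2 b a)) (negRes-≡⇒∣ p (ℕP.*-monoʳ-≤ 2 a≤b) eq)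
      p∣b∸a : p ∣ b ℕ.∸ a
      p∣b∸a with euclidsLemma 2 (b ℕ.∸ a) p-prime p∣2[b∸a]
      ... | inj₁ p∣2   = contradiction p∣2 p∤2
      ... | inj₂ p∣b∸a = p∣b∸a

  negRes-2*-injective : ∀ {a b} → a < p → b < p → negRes p (2 ℕ.* a) ≡ negRes p (2 ℕ.* b) → a ≡ b
  negRes-2*-injective {a} {b} a<p b<p eq with ℕP.≤-total a b
  ... | inj₁ a≤b = ℕP.≤-antisym a≤b (2*-gap a≤b b<p eq)
  ... | inj₂ b≤a = ℕP.≤-antisym (2*-gap b≤a a<p (sym eq)) b≤a

negRes-multiple : ∀ p .{{_ : NonZero p}} c → negRes p (c ℕ.* p) ≡ 0
negRes-multiple p c = ∣∧<⇒≡0 p∣negRes (negRes<p p (c ℕ.* p))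
  where
  p∣negRes : p ∣ negRes p (c ℕ.* p)
  p∣negRes = ∣m+n∣m⇒∣n (subst (p ∣_) (ℕP.+-comm _ (c ℕ.* p)) (negRes-∣ p (c ℕ.* p))) (n∣m*n c)

forbidden≡ : ∀ p t → forbidden p (+ t) ≡ map (negRes p ∘ (2 ℕ.*_)) (0 ∷ 1 ∷ t ∷ suc t ∷ [])
forbidden≡ p t = cong₂ (λ x y → res (+ 0) p ∷ res (ℤ.- (+ 2)) p ∷ res x p ∷ res y p ∷ []) third fourth
  where
  third : ℤ.- (+ 2 ℤ.* + t) ≡ ℤ.- (+ (2 ℕ.* t))
  third = cong ℤ.-_ (sym (ℤP.pos-* 2 t))
  fourth : ℤ.- (+ 2) ℤ.- (+ 2 ℤ.* + t) ≡ ℤ.- (+ (2 ℕ.* suc t))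
  fourth = begin
    ℤ.- (+ 2) ℤ.- (+ 2 ℤ.* + t)       ≡⟨ cong (λ x → ℤ.- (+ 2) ℤ.+ ℤ.- x) (sym (ℤP.pos-* 2 t)) ⟩
    ℤ.- (+ 2) ℤ.+ ℤ.- (+ (2 ℕ.* t))   ≡⟨ sym (ℤP.neg-distrib-+ (+ 2) (+ (2 ℕ.* t))) ⟩
    ℤ.- (+ 2 ℤ.+ + (2 ℕ.* t))         ≡⟨ cong ℤ.-_ (sym (ℤP.pos-+ 2 (2 ℕ.* t))) ⟩
    ℤ.- (+ (2 ℕ.+ 2 ℕ.* t))           ≡⟨ cong (ℤ.-_ ∘ +_) (sym (ℕP.*-suc 2 t)) ⟩
    ℤ.- (+ (2 ℕ.* suc t))             ∎
    where open ≡-Reasoning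

allowedSum : ℕ → ℕ
allowedSum p = (p ℕ.∸ 2) ℕ.* (p ℕ.∸ 2)

allowedSquareSum : ℕ → ℕ
allowedSquareSum p =
  (p ℕ.∸ 2) ℕ.* (p ℕ.∸ 2) ℕ.+ 2 ℕ.* ((p ℕ.∸ 3) ℕ.* (p ℕ.∸ 3)) ℕ.+ (p ℕ.∸ 3) ℕ.* ((p ℕ.∸ 4) ℕ.* (p ℕ.∸ 4))

Rclosed : ℕ → ℚ
Rclosed p = ι (p ℕ.* allowedSquareSum p) ÷' ι (allowedSum p ℕ.* allowedSum p)

-- The forbidden residues are −2t mod p for t = 0, 1, d, d + 1. Since p is odd they
-- coincide exactly when the t's agree mod p, so d = 0 leaves p − 2 allowed residues,
-- d = 1 and d = p − 1 leave p − 3, and every other d leaves p − 4.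
module LocalFactor (k : ℕ) (p-prime : Prime (5 ℕ.+ k)) where

  p : ℕ
  p = 5 ℕ.+ k

  allowed : ℕ → ℕ
  allowed t = avoiding (forbidden p (+ t)) (upTo p)

  private
    forbiddenAt : ℕ → ℕ
    forbiddenAt = negRes p ∘ (2 ℕ.*_)

    p∤2 : ¬ p ∣ 2
    p∤2 p∣2 with ∣⇒≤ p∣2
    ... | s≤s (s≤s ())

    forbiddenAt⁺ : ∀ xs ys → xs ⊆ ys → map forbiddenAt xs ⊆ map forbiddenAt ys
    forbiddenAt⁺ xs ys = ⊆P.map⁺ forbiddenAt

    allowed-from-indices : ∀ t ts c → let F = map forbiddenAt (0 ∷ 1 ∷ t ∷ suc t ∷ []) in
                           F ⊆ map forbiddenAt ts → map forbiddenAt ts ⊆ F → Unique ts → All (_< p) ts →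
                           length ts ℕ.+ c ≡ p → allowed t ≡ c
    allowed-from-indices t ts c F⊆ ⊆F u ts<p len+c≡p = ℕP.+-cancelˡ-≡ (length ts) _ _ (begin
      length ts ℕ.+ allowed t                                        ≡⟨ ℕP.+-comm (length ts) _ ⟩
      allowed t ℕ.+ length ts                                        ≡⟨ cong₂ ℕ._+_ allowed≡ (sym (ListP.length-map forbiddenAt ts)) ⟩
      avoiding (map forbiddenAt ts) (upTo p) ℕ.+ length (map forbiddenAt ts) ≡⟨ avoiding-unique p unique below ⟩
      p                                                              ≡⟨ sym len+c≡p ⟩
      length ts ℕ.+ c                                                ∎)
      where
      open ≡-Reasoning
      allowed≡ : allowed t ≡ avoiding (map forbiddenAt ts) (upTo p)
      allowed≡ = trans (cong (λ L → avoiding L (upTo p)) (forbidden≡ p t)) (avoiding-cong F⊆ ⊆F (upTo p))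
      unique : Unique (map forbiddenAt ts)
      unique = map-unique forbiddenAt (negRes-2*-injective p-prime p∤2) ts<p u
      below : All (_< p) (map forbiddenAt ts)
      below = AllP.map⁺ (All.universal (λ t → negRes<p p (2 ℕ.* t)) ts)

  allowed-0 : allowed 0 ≡ 3 ℕ.+ k
  allowed-0 = allowed-from-indices 0 (0 ∷ 1 ∷ []) (3 ℕ.+ k)
    (forbiddenAt⁺ (0 ∷ 1 ∷ 0 ∷ 1 ∷ []) (0 ∷ 1 ∷ [])
      λ { (here e) → here e ; (there (here e)) → there (here e)
        ; (there (there (here e))) → here e ; (there (there (there (here e)))) → there (here e) })
    (forbiddenAt⁺ (0 ∷ 1 ∷ []) (0 ∷ 1 ∷ 0 ∷ 1 ∷ []) (⊆P.xs⊆xs++ys (0 ∷ 1 ∷ []) (0 ∷ 1 ∷ [])))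
    (((λ ()) ∷ []) ∷ [] ∷ []) (z<s ∷ s<s z<s ∷ []) refl

  allowed-1 : allowed 1 ≡ 2 ℕ.+ k
  allowed-1 = allowed-from-indices 1 (0 ∷ 1 ∷ 2 ∷ []) (2 ℕ.+ k)
    (forbiddenAt⁺ (0 ∷ 1 ∷ 1 ∷ 2 ∷ []) (0 ∷ 1 ∷ 2 ∷ [])
      λ { (here e) → here e ; (there (here e)) → there (here e)
        ; (there (there (here e))) → there (here e) ; (there (there (there (here e)))) → there (there (here e)) })
    (forbiddenAt⁺ (0 ∷ 1 ∷ 2 ∷ []) (0 ∷ 1 ∷ 1 ∷ 2 ∷ [])
      λ { (here e) → here e ; (there (here e)) → there (here e) ; (there (there (here e))) → there (there (there (here e))) })
    (((λ ()) ∷ (λ ()) ∷ []) ∷ ((λ ()) ∷ []) ∷ [] ∷ []) (z<s ∷ s<s z<s ∷ s<s (s<s z<s) ∷ []) refl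

  allowed-middle : ∀ u → 3 ℕ.+ u < p → allowed (2 ℕ.+ u) ≡ 1 ℕ.+ k
  allowed-middle u 3+u<p = allowed-from-indices (2 ℕ.+ u) (0 ∷ 1 ∷ 2 ℕ.+ u ∷ 3 ℕ.+ u ∷ []) (1 ℕ.+ k)
    ⊆P.⊆-refl ⊆P.⊆-refl
    (((λ ()) ∷ (λ ()) ∷ (λ ()) ∷ []) ∷ ((λ ()) ∷ (λ ()) ∷ []) ∷ (ℕP.<⇒≢ (ℕP.n<1+n (2 ℕ.+ u)) ∷ []) ∷ [] ∷ [])
    (z<s ∷ s<s z<s ∷ ℕP.<-trans (ℕP.n<1+n (2 ℕ.+ u)) 3+u<p ∷ 3+u<p ∷ []) refl

  allowed-last : allowed (4 ℕ.+ k) ≡ 2 ℕ.+ k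
  allowed-last = allowed-from-indices (4 ℕ.+ k) ts (2 ℕ.+ k)
    (subst (_⊆ map forbiddenAt ts) (sym F≡)
      (forbiddenAt⁺ (0 ∷ 1 ∷ 4 ℕ.+ k ∷ 0 ∷ []) ts
        λ { (here e) → here e ; (there (here e)) → there (here e)
          ; (there (there (here e))) → there (there (here e)) ; (there (there (there (here e)))) → here e }))
    (subst (map forbiddenAt ts ⊆_) (sym F≡) (forbiddenAt⁺ ts (0 ∷ 1 ∷ 4 ℕ.+ k ∷ 0 ∷ []) (⊆P.xs⊆xs++ys ts (0 ∷ []))))
    (((λ ()) ∷ (λ ()) ∷ []) ∷ ((λ ()) ∷ []) ∷ [] ∷ []) (z<s ∷ s<s z<s ∷ ℕP.n<1+n (4 ℕ.+ k) ∷ []) refl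
    where
    ts = 0 ∷ 1 ∷ 4 ℕ.+ k ∷ []
    F≡ : map forbiddenAt (0 ∷ 1 ∷ 4 ℕ.+ k ∷ 5 ℕ.+ k ∷ []) ≡ map forbiddenAt (0 ∷ 1 ∷ 4 ℕ.+ k ∷ 0 ∷ [])
    F≡ = cong (λ x → forbiddenAt 0 ∷ forbiddenAt 1 ∷ forbiddenAt (4 ℕ.+ k) ∷ x ∷ []) (negRes-multiple p 2)

  Σ-allowed : ∀ (G : ℕ → ℚ) →
              Σ[ t < p ] G (allowed t) ≡ G (3 ℕ.+ k) + (G (2 ℕ.+ k) + (ι (2 ℕ.+ k) * G (1 ℕ.+ k) + G (2 ℕ.+ k)))
  Σ-allowed G = cong₂ _+_ (cong G allowed-0) (cong₂ _+_ (cong G allowed-1) (begin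
    Σ[ u < 3 ℕ.+ k ] G (allowed (2 ℕ.+ u))                                    ≡⟨ Σ-last (2 ℕ.+ k) (λ u → G (allowed (2 ℕ.+ u))) ⟩
    Σ[ u < 2 ℕ.+ k ] G (allowed (2 ℕ.+ u)) + G (allowed (4 ℕ.+ k))           ≡⟨ cong₂ _+_ middle (cong G allowed-last) ⟩
    ι (2 ℕ.+ k) * G (1 ℕ.+ k) + G (2 ℕ.+ k)                                  ∎))
    where
    open ≡-Reasoning
    middle : Σ[ u < 2 ℕ.+ k ] G (allowed (2 ℕ.+ u)) ≡ ι (2 ℕ.+ k) * G (1 ℕ.+ k)
    middle = trans (Σ-cong (2 ℕ.+ k) (λ u u<2+k → cong G (allowed-middle u (s<s (s<s (s<s u<2+k))))))
                   (Σ-const (2 ℕ.+ k) (G (1 ℕ.+ k)))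

  Σ-ι-allowed : ∀ (g : ℕ → ℕ) →
                Σ[ t < p ] ι (g (allowed t)) ≡ ι (g (3 ℕ.+ k) ℕ.+ (g (2 ℕ.+ k) ℕ.+ ((2 ℕ.+ k) ℕ.* g (1 ℕ.+ k) ℕ.+ g (2 ℕ.+ k))))
  Σ-ι-allowed g = begin
    Σ[ t < p ] ι (g (allowed t))
      ≡⟨ Σ-allowed (ι ∘ g) ⟩
    ι a + (ι b + (ι (2 ℕ.+ k) * ι c + ι b))
      ≡⟨ cong (λ x → ι a + (ι b + (x + ι b))) (sym (ι-* (2 ℕ.+ k) c)) ⟩
    ι a + (ι b + (ι ((2 ℕ.+ k) ℕ.* c) + ι b))
      ≡⟨ cong (λ x → ι a + (ι b + x)) (sym (ι-+ ((2 ℕ.+ k) ℕ.* c) b)) ⟩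
    ι a + (ι b + ι ((2 ℕ.+ k) ℕ.* c ℕ.+ b))
      ≡⟨ cong (λ x → ι a + x) (sym (ι-+ b ((2 ℕ.+ k) ℕ.* c ℕ.+ b))) ⟩
    ι a + ι (b ℕ.+ ((2 ℕ.+ k) ℕ.* c ℕ.+ b))
      ≡⟨ sym (ι-+ a (b ℕ.+ ((2 ℕ.+ k) ℕ.* c ℕ.+ b))) ⟩
    ι (a ℕ.+ (b ℕ.+ ((2 ℕ.+ k) ℕ.* c ℕ.+ b)))
      ∎
    where
    open ≡-Reasoning
    a = g (3 ℕ.+ k)
    b = g (2 ℕ.+ k)
    c = g (1 ℕ.+ k)

  Σ-allowed-sum : Σ[ t < p ] ι (allowed t) ≡ ι (allowedSum p)
  Σ-allowed-sum = trans (Σ-ι-allowed (λ c → c)) (cong ι (identity k))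
    where
    identity : ∀ k → 3 ℕ.+ k ℕ.+ (2 ℕ.+ k ℕ.+ ((2 ℕ.+ k) ℕ.* (1 ℕ.+ k) ℕ.+ (2 ℕ.+ k))) ≡ (3 ℕ.+ k) ℕ.* (3 ℕ.+ k)
    identity = solve-∀

  Σ-allowed-square-sum : Σ[ t < p ] ι (allowed t ℕ.* allowed t) ≡ ι (allowedSquareSum p)
  Σ-allowed-square-sum = trans (Σ-ι-allowed (λ c → c ℕ.* c)) (cong ι (identity k))
    where
    identity : ∀ k → (3 ℕ.+ k) ℕ.* (3 ℕ.+ k) ℕ.+ ((2 ℕ.+ k) ℕ.* (2 ℕ.+ k) ℕ.+ ((2 ℕ.+ k) ℕ.* ((1 ℕ.+ k) ℕ.* (1 ℕ.+ k)) ℕ.+ (2 ℕ.+ k) ℕ.* (2 ℕ.+ k)))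
                    ≡ (3 ℕ.+ k) ℕ.* (3 ℕ.+ k) ℕ.+ 2 ℕ.* ((2 ℕ.+ k) ℕ.* (2 ℕ.+ k)) ℕ.+ (2 ℕ.+ k) ℕ.* ((1 ℕ.+ k) ℕ.* (1 ℕ.+ k))
    identity = solve-∀

  private
    u : ℚ
    u = recip (ι p)

    τ≡ : ∀ t → τ p (+ t) ≡ ι (allowed t) * u
    τ≡ t = /≡ι*recip (allowed t) p

  𝔼-τ : 𝔼 p (λ t → τ p (+ t)) ≡ ι (allowedSum p) * u * u
  𝔼-τ = begin
    𝔼 p (λ t → τ p (+ t))                ≡⟨ 𝔼≡Σ*recip p (λ t → τ p (+ t)) ⟩
    Σ[ t < p ] τ p (+ t) * u             ≡⟨ cong (_* u) (Σ-cong p (λ t _ → τ≡ t)) ⟩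
    Σ[ t < p ] (ι (allowed t) * u) * u   ≡⟨ cong (_* u) (Σ-*ʳ p u (λ t → ι (allowed t))) ⟩
    Σ[ t < p ] ι (allowed t) * u * u     ≡⟨ cong (λ x → x * u * u) Σ-allowed-sum ⟩
    ι (allowedSum p) * u * u             ∎
    where open ≡-Reasoning

  𝔼-τ² : 𝔼 p (λ t → τ p (+ t) * τ p (+ t)) ≡ ι (allowedSquareSum p) * (u * u) * u
  𝔼-τ² = begin
    𝔼 p (λ t → τ p (+ t) * τ p (+ t))                 ≡⟨ 𝔼≡Σ*recip p (λ t → τ p (+ t) * τ p (+ t)) ⟩
    Σ[ t < p ] (τ p (+ t) * τ p (+ t)) * u            ≡⟨ cong (_* u) (Σ-cong p (λ t _ → τ²≡ t)) ⟩
    Σ[ t < p ] (ι (allowed t ℕ.* allowed t) * (u * u)) * u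
                                                      ≡⟨ cong (_* u) (Σ-*ʳ p (u * u) (λ t → ι (allowed t ℕ.* allowed t))) ⟩
    Σ[ t < p ] ι (allowed t ℕ.* allowed t) * (u * u) * u ≡⟨ cong (λ x → x * (u * u) * u) Σ-allowed-square-sum ⟩
    ι (allowedSquareSum p) * (u * u) * u              ∎
    where
    open ≡-Reasoning
    τ²≡ : ∀ t → τ p (+ t) * τ p (+ t) ≡ ι (allowed t ℕ.* allowed t) * (u * u)
    τ²≡ t = begin
      τ p (+ t) * τ p (+ t)                          ≡⟨ cong₂ _*_ (τ≡ t) (τ≡ t) ⟩
      ι (allowed t) * u * (ι (allowed t) * u)        ≡⟨ solve 2 (λ a u → a :* u :* (a :* u) := a :* a :* (u :* u)) refl (ι (allowed t)) u ⟩
      ι (allowed t) * ι (allowed t) * (u * u)        ≡⟨ cong (_* (u * u)) (sym (ι-* (allowed t) (allowed t))) ⟩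
      ι (allowed t ℕ.* allowed t) * (u * u)          ∎

  𝔼-τ-pos : 0ℚ ℚ.< 𝔼 p (λ t → τ p (+ t))
  𝔼-τ-pos = subst (0ℚ ℚ.<_) (sym 𝔼-τ) (*-pos (*-pos (ι-pos (allowedSum p)) (recip-ι-pos p)) (recip-ι-pos p))

  R≡Rclosed : R p ≡ Rclosed p
  R≡Rclosed = begin
    R p
      ≡⟨ cong₂ _÷'_ 𝔼-τ² (cong₂ _*_ 𝔼-τ 𝔼-τ) ⟩
    (ι S₂ * (u * u) * u) ÷' (ι S₁ * u * u * (ι S₁ * u * u))
      ≡⟨ ÷'≡*recip (ι S₂ * (u * u) * u) (ι S₁ * u * u * (ι S₁ * u * u)) ⟩
    ι S₂ * (u * u) * u * recip (ι S₁ * u * u * (ι S₁ * u * u))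
      ≡⟨ cong (λ y → ι S₂ * (u * u) * u * recip y) (regroup-denominator (ι S₁) u) ⟩
    ι S₂ * (u * u) * u * recip (ι S₁ * ι S₁ * (u * u * u * u))
      ≡⟨ cong (ι S₂ * (u * u) * u *_) (trans (recip-* (ι S₁ * ι S₁) (u * u * u * u)) (cong (v *_) recip-u⁴)) ⟩
    ι S₂ * (u * u) * u * (v * (x * x * x * x))
      ≡⟨ regroup (ι S₂) v u x ⟩
    x * ι S₂ * v * (u * x * (u * x) * (u * x))
      ≡⟨ cong (λ y → x * ι S₂ * v * (y * y * y)) u*x≡1 ⟩
    x * ι S₂ * v * 1ℚ
      ≡⟨ ℚP.*-identityʳ (x * ι S₂ * v) ⟩
    x * ι S₂ * recip (ι S₁ * ι S₁)
      ≡⟨ sym (cong₂ (λ a b → a * recip b) (ι-* p S₂) (ι-* S₁ S₁)) ⟩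
    ι (p ℕ.* S₂) * recip (ι (S₁ ℕ.* S₁))
      ≡⟨ sym (÷'≡*recip (ι (p ℕ.* S₂)) (ι (S₁ ℕ.* S₁))) ⟩
    Rclosed p
      ∎
    where
    open ≡-Reasoning
    S₁ = allowedSum p
    S₂ = allowedSquareSum p
    x = ι p
    v = recip (ι S₁ * ι S₁)
    regroup-denominator : ∀ s u → s * u * u * (s * u * u) ≡ s * s * (u * u * u * u)
    regroup-denominator = solve 2 (λ s u → s :* u :* u :* (s :* u :* u) := s :* s :* (u :* u :* u :* u)) refl
    regroup : ∀ s v u x → s * (u * u) * u * (v * (x * x * x * x)) ≡ x * s * v * (u * x * (u * x) * (u * x))
    regroup = solve 4 (λ s v u x → s :* (u :* u) :* u :* (v :* (x :* x :* x :* x))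
                                   := x :* s :* v :* ((u :* x) :* (u :* x) :* (u :* x))) refl
    u*x≡1 : u * x ≡ 1ℚ
    u*x≡1 = trans (ℚP.*-comm u x) (*-recipʳ x (ι≢0 p))
    recip-u⁴ : recip (u * u * u * u) ≡ x * x * x * x
    recip-u⁴ = recip-unique (u * u * u * u) (x * x * x * x) (begin
      u * u * u * u * (x * x * x * x)  ≡⟨ solve 2 (λ u x → u :* u :* u :* u :* (x :* x :* x :* x)
                                                          := (u :* x) :* (u :* x) :* (u :* x) :* (u :* x)) refl u x ⟩
      u * x * (u * x) * (u * x) * (u * x)  ≡⟨ cong (λ y → y * y * y * y) u*x≡1 ⟩
      1ℚ                                   ∎)


drop-applyUpTo⁺ : ∀ {P : ℕ → Set} k n (f : ℕ → ℕ) → (∀ i → k ≤ i → P (f i)) → All P (drop k (applyUpTo f n))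
drop-applyUpTo⁺ zero    n       f Pf = AllP.applyUpTo⁺₂ f n (λ i → Pf i z≤n)
drop-applyUpTo⁺ (suc k) zero    f Pf = []
drop-applyUpTo⁺ (suc k) (suc n) f Pf = drop-applyUpTo⁺ k n (f ∘ suc) (λ i k≤i → Pf (suc i) (s≤s k≤i))

𝓑'-prime : ∀ m → All Prime (𝓑' m)
𝓑'-prime m = AllP.all-filter prime? (drop 5 (upTo (suc m)))

𝓑'-≥5 : ∀ m → All (5 ≤_) (𝓑' m)
𝓑'-≥5 m = AllP.filter⁺ prime? (drop-applyUpTo⁺ 5 (suc m) (λ i → i) (λ i 5≤i → 5≤i))

𝓑'-unique : ∀ m → Unique (𝓑' m)
𝓑'-unique m = UniqueP.filter⁺ prime? (UniqueP.drop⁺ 5 (UniqueP.upTo⁺ (suc m)))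

𝔼-τ-pos : ∀ {p} → Prime p → 5 ≤ p → 0ℚ ℚ.< 𝔼 p (λ t → τ p (+ t))
𝔼-τ-pos p-prime (s≤s (s≤s (s≤s (s≤s (s≤s {n = k} _))))) = LocalFactor.𝔼-τ-pos k p-prime

R≡Rclosed : ∀ {p} → Prime p → 5 ≤ p → R p ≡ Rclosed p
R≡Rclosed p-prime (s≤s (s≤s (s≤s (s≤s (s≤s {n = k} _))))) = LocalFactor.R≡Rclosed k p-prime


variance-ratio : ∀ m₀ → Var m₀ ÷' (hbar m₀ * hbar m₀) ≡ Pm m₀
variance-ratio m₀ = relative-variance-crtProduct (λ p r → τ p (+ r)) (𝓑' m₀) (𝓑'-prime m₀) (𝓑'-unique m₀)
  (All.zipWith (λ (p-prime , 5≤p) → 𝔼-τ-pos p-prime 5≤p) (𝓑'-prime m₀ , 𝓑'-≥5 m₀))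


-- Monotone bounds for ∏ R_p

tailBound : ℕ → ℚ
tailBound (suc (suc n)) = + ((2 ℕ.+ n) ℕ.* (1 ℕ.+ n) ℕ.+ 4) / ((2 ℕ.+ n) ℕ.* (1 ℕ.+ n))
tailBound _             = 1ℚ

tailBound≡1+ : ∀ n → tailBound (2 ℕ.+ n) ≡ 1ℚ + + 4 / ((2 ℕ.+ n) ℕ.* (1 ℕ.+ n))
tailBound≡1+ n = sym (trans (/-+-/ 1 1 4 D) (/-cross (1 ℕ.* D ℕ.+ 4 ℕ.* 1) (1 ℕ.* D) (D ℕ.+ 4) D (identity D)))
  where
  D = (2 ℕ.+ n) ℕ.* (1 ℕ.+ n)
  identity : ∀ D → (1 ℕ.* D ℕ.+ 4 ℕ.* 1) ℕ.* D ≡ (D ℕ.+ 4) ℕ.* (1 ℕ.* D)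
  identity = solve-∀

1≤tailBound : ∀ n → 1ℚ ℚ.≤ tailBound n
1≤tailBound (suc (suc n)) = /-mono-≤ 1 1 (D ℕ.+ 4) D (subst₂ _≤_ (sym (ℕP.*-identityˡ D)) (sym (ℕP.*-identityʳ (D ℕ.+ 4))) (ℕP.m≤m+n D 4))
  where D = (2 ℕ.+ n) ℕ.* (1 ℕ.+ n)
1≤tailBound 0 = ℚP.≤-refl
1≤tailBound 1 = ℚP.≤-refl

tailBound-suc≤ : ∀ n → tailBound (3 ℕ.+ n) ℚ.≤ tailBound (2 ℕ.+ n)
tailBound-suc≤ n = /-mono-≤ ((3 ℕ.+ n) ℕ.* (2 ℕ.+ n) ℕ.+ 4) ((3 ℕ.+ n) ℕ.* (2 ℕ.+ n)) ((2 ℕ.+ n) ℕ.* (1 ℕ.+ n) ℕ.+ 4) ((2 ℕ.+ n) ℕ.* (1 ℕ.+ n))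
  (≤-witness _ (8 ℕ.* (2 ℕ.+ n)) (identity n))
  where
  identity : ∀ n → ((3 ℕ.+ n) ℕ.* (2 ℕ.+ n) ℕ.+ 4) ℕ.* ((2 ℕ.+ n) ℕ.* (1 ℕ.+ n)) ℕ.+ 8 ℕ.* (2 ℕ.+ n)
                   ≡ ((2 ℕ.+ n) ℕ.* (1 ℕ.+ n) ℕ.+ 4) ℕ.* ((3 ℕ.+ n) ℕ.* (2 ℕ.+ n))
  identity = solve-∀

Rclosed≡ : ∀ p .{{_ : ℕ.NonZero (allowedSum p ℕ.* allowedSum p)}} →
           Rclosed p ≡ + (p ℕ.* allowedSquareSum p) / (allowedSum p ℕ.* allowedSum p)
Rclosed≡ p = ι÷'ι (p ℕ.* allowedSquareSum p) (allowedSum p ℕ.* allowedSum p)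

1≤Rclosed : ∀ k → 1ℚ ℚ.≤ Rclosed (5 ℕ.+ k)
1≤Rclosed k = subst (1ℚ ℚ.≤_) (sym (Rclosed≡ p))
  (/-mono-≤ 1 1 (p ℕ.* allowedSquareSum p) (allowedSum p ℕ.* allowedSum p) (≤-witness _ (6 ℕ.* k ℕ.+ 14) (identity k)))
  where
  p = 5 ℕ.+ k
  identity : ∀ k → 1 ℕ.* ((3 ℕ.+ k) ℕ.* (3 ℕ.+ k) ℕ.* ((3 ℕ.+ k) ℕ.* (3 ℕ.+ k))) ℕ.+ (6 ℕ.* k ℕ.+ 14)
                   ≡ (5 ℕ.+ k) ℕ.* ((3 ℕ.+ k) ℕ.* (3 ℕ.+ k) ℕ.+ 2 ℕ.* ((2 ℕ.+ k) ℕ.* (2 ℕ.+ k)) ℕ.+ (2 ℕ.+ k) ℕ.* ((1 ℕ.+ k) ℕ.* (1 ℕ.+ k))) ℕ.* 1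
  identity = solve-∀

1≤R : ∀ {p} → Prime p → 5 ≤ p → 1ℚ ℚ.≤ R p
1≤R p-prime 5≤p@(s≤s (s≤s (s≤s (s≤s (s≤s {n = k} _))))) = subst (1ℚ ℚ.≤_) (sym (R≡Rclosed p-prime 5≤p)) (1≤Rclosed k)

Rclosed*tailBound≤ : ∀ t → Rclosed (11 ℕ.+ t) * tailBound (11 ℕ.+ t) ℚ.≤ tailBound (10 ℕ.+ t)
Rclosed*tailBound≤ t = begin
  Rclosed P * tailBound P               ≡⟨ cong (_* tailBound P) (Rclosed≡ P) ⟩
  + (P ℕ.* S₂) / (X² ℕ.* X²) * (+ C / D) ≡⟨ /-*-/ (P ℕ.* S₂) (X² ℕ.* X²) C D ⟩
  (+ (P ℕ.* S₂ ℕ.* C) / (X² ℕ.* X² ℕ.* D)) {{ℕP.m*n≢0 (X² ℕ.* X²) D}}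
    ≤⟨ /-mono-≤ (P ℕ.* S₂ ℕ.* C) (X² ℕ.* X² ℕ.* D) E F {{ℕP.m*n≢0 (X² ℕ.* X²) D}} cross ⟩
  + E / F                               ∎
  where
  open ℚP.≤-Reasoning
  P  = 11 ℕ.+ t
  X  = 9 ℕ.+ t
  X² = X ℕ.* X
  S₂ = allowedSquareSum P
  C  = P ℕ.* (10 ℕ.+ t) ℕ.+ 4
  D  = P ℕ.* (10 ℕ.+ t)
  E  = (10 ℕ.+ t) ℕ.* X ℕ.+ 4
  F  = (10 ℕ.+ t) ℕ.* X
  core-identity : ∀ t → ((9 ℕ.+ t) ℕ.* (9 ℕ.+ t) ℕ.+ 2 ℕ.* ((8 ℕ.+ t) ℕ.* (8 ℕ.+ t)) ℕ.+ (8 ℕ.+ t) ℕ.* ((7 ℕ.+ t) ℕ.* (7 ℕ.+ t)))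
                          ℕ.* ((11 ℕ.+ t) ℕ.* (10 ℕ.+ t) ℕ.+ 4) ℕ.+ (12 ℕ.+ 18 ℕ.* t ℕ.+ 2 ℕ.* (t ℕ.* t))
                        ≡ (9 ℕ.+ t) ℕ.* (9 ℕ.+ t) ℕ.* (9 ℕ.+ t) ℕ.* ((10 ℕ.+ t) ℕ.* (9 ℕ.+ t) ℕ.+ 4)
  core-identity = solve-∀
  core : S₂ ℕ.* C ≤ X ℕ.* X ℕ.* X ℕ.* E
  core = ≤-witness _ _ (core-identity t)
  lhs-identity : ∀ P P₁ X S C → P ℕ.* S ℕ.* C ℕ.* (P₁ ℕ.* X) ≡ S ℕ.* C ℕ.* (P ℕ.* P₁ ℕ.* X)
  lhs-identity = solve-∀
  rhs-identity : ∀ P P₁ X E → X ℕ.* X ℕ.* X ℕ.* E ℕ.* (P ℕ.* P₁ ℕ.* X) ≡ E ℕ.* (X ℕ.* X ℕ.* (X ℕ.* X) ℕ.* (P ℕ.* P₁))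
  rhs-identity = solve-∀
  cross : P ℕ.* S₂ ℕ.* C ℕ.* F ≤ E ℕ.* (X² ℕ.* X² ℕ.* D)
  cross = subst₂ _≤_ (sym (lhs-identity P (10 ℕ.+ t) X S₂ C)) (rhs-identity P (10 ℕ.+ t) X E)
            (ℕP.*-monoˡ-≤ (P ℕ.* (10 ℕ.+ t) ℕ.* X) core)

Rproduct : ℕ → ℚ
Rproduct m = prodℚ (map R (𝓑' m))

stepFactor : ℕ → ℚ
stepFactor q = prodℚ (map R (filter prime? [ q ]))

Rproduct-suc : ∀ j → Rproduct (5 ℕ.+ j) ≡ Rproduct (4 ℕ.+ j) * stepFactor (5 ℕ.+ j)
Rproduct-suc j = begin
  prodℚ (map R (filter prime? (applyUpTo (5 ℕ.+_) (suc j))))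
    ≡⟨ cong (prodℚ ∘ map R ∘ filter prime?) (sym (ListP.applyUpTo-∷ʳ (5 ℕ.+_) j)) ⟩
  prodℚ (map R (filter prime? (applyUpTo (5 ℕ.+_) j ++ [ 5 ℕ.+ j ])))
    ≡⟨ cong (prodℚ ∘ map R) (ListP.filter-++ prime? (applyUpTo (5 ℕ.+_) j) [ 5 ℕ.+ j ]) ⟩
  prodℚ (map R (filter prime? (applyUpTo (5 ℕ.+_) j) ++ filter prime? [ 5 ℕ.+ j ]))
    ≡⟨ prodℚ-++ R (filter prime? (applyUpTo (5 ℕ.+_) j)) (filter prime? [ 5 ℕ.+ j ]) ⟩
  Rproduct (4 ℕ.+ j) * stepFactor (5 ℕ.+ j)
    ∎
  where open ≡-Reasoning

stepFactor-prime : ∀ {q} → Prime q → stepFactor q ≡ R q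
stepFactor-prime {q} q-prime = trans (cong (prodℚ ∘ map R) (ListP.filter-accept prime? {xs = []} q-prime)) (ℚP.*-identityʳ (R q))

stepFactor-composite : ∀ {q} → ¬ Prime q → stepFactor q ≡ 1ℚ
stepFactor-composite {q} ¬q-prime = cong (prodℚ ∘ map R) (ListP.filter-reject prime? {xs = []} ¬q-prime)

1≤stepFactor : ∀ {q} → 5 ≤ q → 1ℚ ℚ.≤ stepFactor q
1≤stepFactor {q} 5≤q = cases (prime? q)
  where
  cases : Dec (Prime q) → 1ℚ ℚ.≤ stepFactor q
  cases (yes q-prime) = subst (1ℚ ℚ.≤_) (sym (stepFactor-prime q-prime)) (1≤R q-prime 5≤q)
  cases (no ¬q-prime) = ℚP.≤-reflexive (sym (stepFactor-composite ¬q-prime))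

stepFactor*tailBound≤ : ∀ t → stepFactor (11 ℕ.+ t) * tailBound (11 ℕ.+ t) ℚ.≤ tailBound (10 ℕ.+ t)
stepFactor*tailBound≤ t = cases (prime? q)
  where
  q = 11 ℕ.+ t
  cases : Dec (Prime q) → stepFactor q * tailBound q ℚ.≤ tailBound (10 ℕ.+ t)
  cases (yes q-prime) = subst (λ r → r * tailBound q ℚ.≤ tailBound (10 ℕ.+ t))
    (sym (trans (stepFactor-prime q-prime) (R≡Rclosed q-prime (ℕP.m≤m+n 5 (6 ℕ.+ t))))) (Rclosed*tailBound≤ t)
  cases (no ¬q-prime) = subst (λ r → r * tailBound q ℚ.≤ tailBound (10 ℕ.+ t))
    (sym (stepFactor-composite ¬q-prime)) (ℚP.≤-trans (ℚP.≤-reflexive (ℚP.*-identityˡ (tailBound q))) (tailBound-suc≤ (8 ℕ.+ t)))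

1≤Rproduct : ∀ m → 1ℚ ℚ.≤ Rproduct m
1≤Rproduct m = 1≤prodℚ R (All.zipWith (λ (p-prime , 5≤p) → 1≤R p-prime 5≤p) (𝓑'-prime m , 𝓑'-≥5 m))

Rproduct-step≤ : ∀ m → Rproduct m ℚ.≤ Rproduct (suc m)
Rproduct-step≤ 0 = ℚP.≤-refl
Rproduct-step≤ 1 = ℚP.≤-refl
Rproduct-step≤ 2 = ℚP.≤-refl
Rproduct-step≤ 3 = ℚP.≤-refl
Rproduct-step≤ (suc (suc (suc (suc j)))) = subst (Rproduct (4 ℕ.+ j) ℚ.≤_) (sym (Rproduct-suc j))
  (x≤x*y (1≤⇒0≤ (1≤Rproduct (4 ℕ.+ j))) (1≤stepFactor (ℕP.m≤m+n 5 j)))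

Rproduct-mono : ∀ {m n} → m ≤ n → Rproduct m ℚ.≤ Rproduct n
Rproduct-mono {m} {n} =
  chain-from-steps {_≼_ = ℚ._≤_} ℚP.≤-refl ℚP.≤-trans Rproduct 0 (λ m _ → Rproduct-step≤ m) {m} {n} z≤n

upperBound : ℕ → ℚ
upperBound m = Rproduct m * tailBound m

upperBound-step≤ : ∀ m → 10 ≤ m → upperBound (suc m) ℚ.≤ upperBound m
upperBound-step≤ _ (s≤s (s≤s (s≤s (s≤s (s≤s (s≤s (s≤s (s≤s (s≤s (s≤s {n = t} _)))))))))) = begin
  Rproduct (11 ℕ.+ t) * tailBound (11 ℕ.+ t)                   ≡⟨ cong (_* tailBound (11 ℕ.+ t)) (Rproduct-suc (6 ℕ.+ t)) ⟩
  Rproduct m * stepFactor (11 ℕ.+ t) * tailBound (11 ℕ.+ t)    ≡⟨ ℚP.*-assoc (Rproduct m) _ _ ⟩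
  Rproduct m * (stepFactor (11 ℕ.+ t) * tailBound (11 ℕ.+ t))  ≤⟨ *-monoˡ-≤-0≤ (1≤⇒0≤ (1≤Rproduct m)) (stepFactor*tailBound≤ t) ⟩
  Rproduct m * tailBound m                                     ∎
  where
  open ℚP.≤-Reasoning
  m = 10 ℕ.+ t

upperBound-antitone : ∀ {m n} → 10 ≤ m → m ≤ n → upperBound n ℚ.≤ upperBound m
upperBound-antitone {m} {n} =
  chain-from-steps {_≼_ = λ x y → y ℚ.≤ x} ℚP.≤-refl (λ y≤x z≤y → ℚP.≤-trans z≤y y≤x) upperBound 10 upperBound-step≤ {m} {n}

Rproduct≤upperBound : ∀ m → Rproduct m ℚ.≤ upperBound m
Rproduct≤upperBound m = x≤x*y (1≤⇒0≤ (1≤Rproduct m)) (1≤tailBound m)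

Rproduct-sandwich : ∀ {N m} → 10 ≤ N → N ≤ m → Rproduct N ℚ.≤ Rproduct m × Rproduct m ℚ.≤ upperBound N
Rproduct-sandwich {N} {m} 10≤N N≤m = Rproduct-mono N≤m , ℚP.≤-trans (Rproduct≤upperBound m) (upperBound-antitone 10≤N N≤m)


Rproduct≡∏Rclosed : ∀ m → Rproduct m ≡ prodℚ (map Rclosed (𝓑' m))
Rproduct≡∏Rclosed m = cong prodℚ (ListP.map-cong-local
  (All.zipWith (λ (p-prime , 5≤p) → R≡Rclosed p-prime 5≤p) (𝓑'-prime m , 𝓑'-≥5 m)))

-- Both numerical bounds are decided by evaluating Rclosed at the primes 5 ≤ p ≤ 100.
Rproduct-100 : + 12415 / 10000 ℚ.≤ Rproduct 100
Rproduct-100 = subst (+ 12415 / 10000 ℚ.≤_) (sym (Rproduct≡∏Rclosed 100)) (toWitness {a? = _ ℚP.≤? _} _)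

upperBound-100 : upperBound 100 ℚ.≤ + 12425 / 10000
upperBound-100 = subst (λ r → r * tailBound 100 ℚ.≤ + 12425 / 10000) (sym (Rproduct≡∏Rclosed 100)) (toWitness {a? = _ ℚP.≤? _} _)

Rproduct-bounds : ∀ {m} → 100 ≤ m → + 12415 / 10000 ℚ.≤ Rproduct m × Rproduct m ℚ.≤ + 12425 / 10000
Rproduct-bounds {m} 100≤m = ℚP.≤-trans Rproduct-100 (proj₁ sandwich) , ℚP.≤-trans (proj₂ sandwich) upperBound-100
  where
  sandwich : Rproduct 100 ℚ.≤ Rproduct m × Rproduct m ℚ.≤ upperBound 100
  sandwich = Rproduct-sandwich (ℕP.m≤m+n 10 90) 100≤m

Pm-limit : ∃[ N ] ((m : ℕ) → N ≤ m → ∣ Pm m - (+ 242 / 1000) ∣ ℚ.≤ (+ 1 / 2000))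
Pm-limit = 100 , λ m 100≤m → ∣x-c∣≤e {Pm m} {+ 242 / 1000} {+ 1 / 2000}
  (ℚP.+-monoˡ-≤ (- 1ℚ) (proj₁ (Rproduct-bounds 100≤m)))
  (ℚP.+-monoˡ-≤ (- 1ℚ) (proj₂ (Rproduct-bounds 100≤m)))

Pm-close : ∀ n′ → 98 ≤ n′ → ∀ {m m′} → 2 ℕ.+ n′ ≤ m → 2 ℕ.+ n′ ≤ m′ →
           ∣ Pm m - Pm m′ ∣ ℚ.≤ + 8 / ((2 ℕ.+ n′) ℕ.* (1 ℕ.+ n′))
Pm-close n′ 98≤n′ {m} {m′} N≤m N≤m′ = begin
  ∣ Pm m - Pm m′ ∣
    ≡⟨ cong ∣_∣ (solve 2 (λ a b → (a :- con 1ℚ) :- (b :- con 1ℚ) := a :- b) refl (Rproduct m) (Rproduct m′)) ⟩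
  ∣ Rproduct m - Rproduct m′ ∣
    ≤⟨ ∣x-y∣≤b-a (proj₁ sandwich) (proj₂ sandwich) (proj₁ sandwich′) (proj₂ sandwich′) ⟩
  upperBound N - Rproduct N
    ≡⟨ cong (λ w → Rproduct N * w - Rproduct N) (tailBound≡1+ n′) ⟩
  Rproduct N * (1ℚ + + 4 / D) - Rproduct N
    ≡⟨ solve 2 (λ a x → a :* (con 1ℚ :+ x) :- a := x :* a) refl (Rproduct N) (+ 4 / D) ⟩
  + 4 / D * Rproduct N
    ≤⟨ *-monoˡ-≤-0≤ (/-mono-≤ 0 1 4 D z≤n) Rproduct-N≤2 ⟩
  + 4 / D * (+ 2 / 1)
    ≡⟨ /-*-/ 4 D 2 1 ⟩
  (+ 8 / (D ℕ.* 1)) {{ℕP.m*n≢0 D 1}}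
    ≡⟨ /-cross 8 (D ℕ.* 1) 8 D {{ℕP.m*n≢0 D 1}} (cong (8 ℕ.*_) (sym (ℕP.*-identityʳ D))) ⟩
  + 8 / D
    ∎
  where
  open ℚP.≤-Reasoning
  N = 2 ℕ.+ n′
  D = N ℕ.* (1 ℕ.+ n′)
  100≤N : 100 ≤ N
  100≤N = s≤s (s≤s 98≤n′)
  sandwich  = Rproduct-sandwich (ℕP.≤-trans (ℕP.m≤m+n 10 90) 100≤N) N≤m
  sandwich′ = Rproduct-sandwich (ℕP.≤-trans (ℕP.m≤m+n 10 90) 100≤N) N≤m′
  Rproduct-N≤2 : Rproduct N ℚ.≤ + 2 / 1
  Rproduct-N≤2 = ℚP.≤-trans (proj₂ (Rproduct-bounds 100≤N)) (toWitness {a? = + 12425 / 10000 ℚP.≤? + 2 / 1} _)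

Pm-cauchy : (ε : ℚ) → 0ℚ ℚ.< ε → ∃[ N ] ((m m′ : ℕ) → N ≤ m → N ≤ m′ → ∣ Pm m - Pm m′ ∣ ℚ.< ε)
Pm-cauchy ε 0<ε = 2 ℕ.+ n′ , λ m m′ N≤m N≤m′ → begin-strict
  ∣ Pm m - Pm m′ ∣   ≤⟨ Pm-close n′ (ℕP.m≤m+n 98 (8 ℕ.* suc d)) N≤m N≤m′ ⟩
  + 8 / D            <⟨ /-mono-< 8 D (suc n) (suc d) 8[1+d]<[1+n]D ⟩
  + suc n / suc d    ≡⟨ sym ε≡ ⟩
  ε                  ∎
  where
  open ℚP.≤-Reasoning
  n = proj₁ (positive-as-fraction ε 0<ε)
  d = proj₁ (proj₂ (positive-as-fraction ε 0<ε))
  ε≡ : ε ≡ + suc n / suc d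
  ε≡ = proj₂ (proj₂ (positive-as-fraction ε 0<ε))
  n′ = 98 ℕ.+ 8 ℕ.* suc d
  D  = (2 ℕ.+ n′) ℕ.* (1 ℕ.+ n′)
  8[1+d]<[1+n]D : 8 ℕ.* suc d ℕ.< suc n ℕ.* D
  8[1+d]<[1+n]D = ℕP.<-≤-trans (ℕP.m<n+m (8 ℕ.* suc d) {100} z<s)
    (ℕP.≤-trans (ℕP.m≤m*n (2 ℕ.+ n′) (1 ℕ.+ n′)) (ℕP.m≤n*m D (suc n)))

theoremC7 : ((m₀ : ℕ) → 5 ≤ m₀ → Var m₀ ÷' (hbar m₀ * hbar m₀) ≡ Pm m₀)
    × ((ε : ℚ) → 0ℚ ℚ.< ε → ∃[ N ] ((m m′ : ℕ) → N ≤ m → N ≤ m′ → ∣ Pm m - Pm m′ ∣ ℚ.< ε))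
    × (∃[ N ] ((m : ℕ) → N ≤ m → ∣ Pm m - (+ 242 / 1000) ∣ ℚ.≤ (+ 1 / 2000)))
theoremC7 = (λ m₀ _ → variance-ratio m₀) , Pm-cauchy , Pm-limit
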